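{- Let $n\geq2$ and let $G_1,\ldots,G_n$ be vertex-disjoint odd cycles with $u_iv_i\in E(G_i)$ for each $i\in[n]$. Let $G$ be the graph obtained from the disjoint union of $G_1,\ldots,G_n$ by identifying $u_1,\ldots,u_n$ as a single vertex $u$ and $v_1,\ldots,v_n$ as a single vertex $v$. Then for each $m\geq 2$, $$P_{DP}(G,m)=\frac{\prod_{i=1}^{n}P_{DP}(G_i,m)}{(m(m-1))^{n-1}}.$$
   Context: All graphs are finite and simple. A cover of a graph $G$ is a pair $\mathcal{H}=(L,H)$ where $H$ is a graph and $L:V(G)\to\mathcal{P}(V(H))$ satisfies: (1) $\{L(u):u\in V(G)\}$ is a partition of $V(H)$ into $|V(G)|$ parts; (2) $H[L(u)]$ is complete for each $u$; (3) if $E_H(L(u),L(v))$ is nonempty then $u=v$ or $uv\in E(G)$; (4) if $uv\in E(G)$ then $E_H(L(u),L(v))$ is a (possibly empty) matching. $\mathcal{H}$ is $m$-fold if $|L(u)|=m$ for all $u$. An $\mathcal{H}$-coloring of $G$ is an independent set of $H$ of size $|V(G)|$. The DP color function $P_{DP}(G,m)$ is the minimum number of $\mathcal{H}$-colorings of $G$ over all $m$-fold covers $\mathcal{H}$ of $G$. -}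

module Defs where

open import Data.Nat using (ℕ; zero; suc; _+_; _*_; _≡ᵇ_; _%_)
open import Data.Bool using (Bool; true; false; _∧_; not; if_then_else_)
open import Data.Fin using (Fin; toℕ)
open import Data.Vec using (Vec; []; _∷_; lookup)
open import Data.List using (List; []; _∷_; map; concatMap; length; filterᵇ; allFin)
open import Data.Nat.ListAction using (sum)
open import Data.Bool.ListAction using (and)
open import Data.Product using (Σ; _×_; _,_; ∃)
open import Data.Sum using (_⊎_)
open import Function.Definitions using (Bijective)
open import Relation.Binary.PropositionalEquality using (_≡_; _≢_)

record Graph : Set where
  field
    V     : ℕ
    adj   : Fin V → Fin V → Bool
    adj-sym  : ∀ x y → adj x y ≡ adj y x
    adj-irr  : ∀ x → adj x x ≡ false
open Graph public

-- An m-fold cover of G. WLOG V(H) = V(G) × Fin m with L(x) = {x} × Fin m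
-- (every m-fold cover is isomorphic to one of this form).
record Cover (G : Graph) (m : ℕ) : Set where
  field
    adjH     : Fin (V G) → Fin m → Fin (V G) → Fin m → Bool
    adjH-sym : ∀ x i y j → adjH x i y j ≡ adjH y j x i
    adjH-irr : ∀ x i → adjH x i x i ≡ false
    clique   : ∀ x i j → i ≢ j → adjH x i x j ≡ true
    respects : ∀ x i y j → x ≢ y → adjH x i y j ≡ true → adj G x y ≡ true
    matching : ∀ x y i j j' → x ≢ y → adjH x i y j ≡ true → adjH x i y j' ≡ true → j ≡ j'
open Cover public

allBoolVecs : (n : ℕ) → List (Vec Bool n)
allBoolVecs zero = [] ∷ []
allBoolVecs (suc n) = concatMap (λ v → (false ∷ v) ∷ (true ∷ v) ∷ []) (allBoolVecs n)

allVecsOf : {A : Set} → List A → (n : ℕ) → List (Vec A n)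
allVecsOf xs zero = [] ∷ []
allVecsOf xs (suc n) = concatMap (λ v → map (λ a → a ∷ v) xs) (allVecsOf xs n)

-- subsets of V(H) = Fin V × Fin m, as a V × m Boolean matrix
HSubset : ℕ → ℕ → Set
HSubset V m = Vec (Vec Bool m) V

allHSubsets : (V m : ℕ) → List (HSubset V m)
allHSubsets V m = allVecsOf (allBoolVecs m) V

mem : {V m : ℕ} → HSubset V m → Fin V → Fin m → Bool
mem S x i = lookup (lookup S x) i

size : {V m : ℕ} → HSubset V m → ℕ
size {V} {m} S = sum (map (λ x → length (filterᵇ (mem S x) (allFin m))) (allFin V))

isIndependent : {G : Graph} {m : ℕ} → Cover G m → HSubset (V G) m → Bool
isIndependent {G} {m} H S =
  and (map (λ x → and (map (λ i → and (map (λ y → and (map (λ j →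
    not (mem S x i ∧ mem S y j ∧ adjH H x i y j)) (allFin m))) (allFin (V G)))) (allFin m))) (allFin (V G)))

isHColoring : {G : Graph} {m : ℕ} → Cover G m → HSubset (V G) m → Bool
isHColoring {G} H S = isIndependent H S ∧ (size S ≡ᵇ V G)

numColorings : {G : Graph} {m : ℕ} → Cover G m → ℕ
numColorings {G} {m} H = length (filterᵇ (isHColoring H) (allHSubsets (V G) m))

IsPDP : Graph → ℕ → ℕ → Set
IsPDP G m k = (Σ (Cover G m) λ H → numColorings H ≡ k) × (∀ (H : Cover G m) → k Data.Nat.≤ numColorings H)

cycAdj : (k : ℕ) → Fin (suc (suc (suc k))) → Fin (suc (suc (suc k))) → Set
cycAdj k a b = (suc (toℕ a) % suc (suc (suc k)) ≡ toℕ b) ⊎ (suc (toℕ b) % suc (suc (suc k)) ≡ toℕ a)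

IsOddCycle : Graph → Set
IsOddCycle G = Σ ℕ λ k → Σ (Fin (V G) → Fin (suc (suc (suc (k + k))))) λ f →
  Bijective _≡_ _≡_ f × (∀ x y → (adj G x y ≡ true → cycAdj (k + k) (f x) (f y))
                                × (cycAdj (k + k) (f x) (f y) → adj G x y ≡ true))

-- G is obtained from the disjoint union of the Gs i by identifying all u i into one
-- vertex and all v i into one vertex; φ i is the quotient map restricted to Gs i.
record IsGluing {n : ℕ} (Gs : Fin n → Graph) (u v : (i : Fin n) → Fin (V (Gs i)))
                (G : Graph) (φ : (i : Fin n) → Fin (V (Gs i)) → Fin (V G)) : Set where
  field
    glue-u : ∀ i j → φ i (u i) ≡ φ j (u j)
    glue-v : ∀ i j → φ i (v i) ≡ φ j (v j)
    only   : ∀ i j a b → φ i a ≡ φ j b →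
               (Σ (i ≡ j) λ { _≡_.refl → a ≡ b }) ⊎ ((a ≡ u i × b ≡ u j) ⊎ (a ≡ v i × b ≡ v j))
    onto   : ∀ x → Σ (Fin n) λ i → Σ (Fin (V (Gs i))) λ a → φ i a ≡ x
    edges  : ∀ x y → (adj G x y ≡ true →
               Σ (Fin n) λ i → Σ (Fin (V (Gs i))) λ a → Σ (Fin (V (Gs i))) λ b →
                 φ i a ≡ x × φ i b ≡ y × adj (Gs i) a b ≡ true)
    edges← : ∀ i a b → adj (Gs i) a b ≡ true → adj G (φ i a) (φ i b) ≡ true

prodFin : (n : ℕ) → (Fin n → ℕ) → ℕ
prodFin zero f = 1
prodFin (suc n) f = f Fin.zero * prodFin n (λ i → f (Fin.suc i))

{-# OPTIONS --safe #-}
module Submission where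

-- Read each odd cycle Gᵢ as a path from u to v with an odd number Kᵢ of interior
-- vertices, closed by the edge uv.  A coloring of G is then the same as colors a, b
-- of u, v together with colorings of the path interiors, so for every m-fold cover H
--   #H-colorings = Σ_{a,b} [(u,a) ≁ (v,b)] · Πᵢ Nᵢ(a, b),
-- where Nᵢ(a, b) counts the H-colorings of the i-th path with end colors a, b.
-- Because the edges of H between two parts are matchings, a transfer-matrix induction
-- gives Nᵢ(a, b) ≥ P≠(Kᵢ), the number of proper colorings of that path with distinct
-- prescribed end colors; this uses that Kᵢ is odd, so that P₌(Kᵢ) = P≠(Kᵢ) + 1.
-- For the same reason every a has at least m − 1 admissible b.  Hence every cover has
-- at least m(m − 1)·Πᵢ P≠(Kᵢ) colorings, and the trivial cover has exactly that many.
-- For n = 1 this reads P_DP(Gᵢ, m) = m(m − 1)·P≠(Kᵢ), and the formula follows.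

open import Defs
open import Data.Nat using (ℕ; _≤_; _*_; _∸_; _^_)
open import Data.Bool using (true)
open import Data.Fin using (Fin)
open import Relation.Binary.PropositionalEquality using (_≡_)

open import Data.Bool using (Bool; false; _∧_; not; T; if_then_else_)
import Data.Bool.Properties as Boolₚ
open import Data.Bool.ListAction using (all)
open import Data.Fin using (toℕ; fromℕ; fromℕ<; inject₁; opposite; punchIn; punchOut)
  renaming (zero to fzero; suc to fsuc)
import Data.Fin.Properties as Finₚ
open Finₚ using (_≟_)
open import Data.Fin.Subset using (⁅_⁆) renaming (⊥ to ∅)
open import Data.Fin.Subset.Properties using (x∈⁅x⁆; x∈⁅y⁆⇒x≡y)
open import Data.List as List using (List; []; _∷_; _++_; concatMap; length; filterᵇ; allFin; cartesianProduct)
import Data.List.Relation.Unary.All.Properties as Allₚ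
import Data.Nat.ListAction as ListAction
open import Data.Nat as ℕ using (zero; suc; _+_; _%_; z≤n; s≤s)
open import Data.Nat.DivMod using (m%n<n; %-distribˡ-+; m%n%n≡m%n; n%n≡0; m<n⇒m%n≡m)
open import Data.Nat.Properties hiding (_≟_)
open import Data.Product using (Σ; ∃; _×_; _,_; proj₁; proj₂)
import Data.Product.Properties as Productₚ
open import Data.Sum using (_⊎_; inj₁; inj₂)
open import Data.Unit using (⊤; tt)
open import Data.Vec using (Vec; []; _∷_; lookup; tabulate; map)
import Data.Vec.Properties as Vecₚ
open import Function using (_∘_; id; _⇔_; mk⇔; Equivalence)
open import Function.Definitions using (Injective)
open import Function.Properties.Equivalence using () renaming (trans to ⇔-trans; sym to ⇔-sym)
open import Relation.Binary.Definitions using (DecidableEquality)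
open import Relation.Binary.PropositionalEquality
open import Relation.Nullary using (Dec; does; yes; no; contradiction; _×-dec_)
open import Relation.Nullary.Decidable using (does-⇔; dec-true; dec-false)
open import Algebra.Properties.Semiring.Sum +-*-semiring
  using (sum-remove; sum-cong-≗; sum-replicate-zero; *-distribʳ-sum) renaming (sum-syntax to ∑<)
open import Algebra.Properties.CommutativeSemigroup +-commutativeSemigroup
  using () renaming (interchange to +-interchange)
open ≡-Reasoning

private
  variable
    A B C : Set

χ : Bool → ℕ
χ true = 1
χ false = 0

χ-∧ : ∀ a b → χ (a ∧ b) ≡ χ a * χ b
χ-∧ true b = sym (+-identityʳ (χ b))
χ-∧ false b = refl

∑ : {A : Set} → List A → (A → ℕ) → ℕ
∑ [] f = 0
∑ (x ∷ xs) f = f x + ∑ xs f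

infix 5 ∑
syntax ∑ xs (λ x → e) = ∑[ x ∈ xs ] e

∑-cong : ∀ (xs : List A) {f g : A → ℕ} → (∀ x → f x ≡ g x) → ∑ xs f ≡ ∑ xs g
∑-cong [] f≗g = refl
∑-cong (x ∷ xs) f≗g = cong₂ _+_ (f≗g x) (∑-cong xs f≗g)

∑-++ : ∀ (xs ys : List A) f → ∑ (xs ++ ys) f ≡ ∑ xs f + ∑ ys f
∑-++ [] ys f = refl
∑-++ (x ∷ xs) ys f = trans (cong (f x +_) (∑-++ xs ys f)) (sym (+-assoc (f x) _ _))

∑-map : ∀ (xs : List A) (g : A → B) f → ∑ (List.map g xs) f ≡ ∑[ x ∈ xs ] f (g x)
∑-map [] g f = refl
∑-map (x ∷ xs) g f = cong (f (g x) +_) (∑-map xs g f)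

∑-concatMap : ∀ (xs : List A) (g : A → List B) f →
  ∑ (concatMap g xs) f ≡ ∑[ x ∈ xs ] ∑ (g x) f
∑-concatMap [] g f = refl
∑-concatMap (x ∷ xs) g f =
  trans (∑-++ (g x) (concatMap g xs) f) (cong (∑ (g x) f +_) (∑-concatMap xs g f))

∑-0 : ∀ (xs : List A) → ∑[ x ∈ xs ] 0 ≡ 0
∑-0 [] = refl
∑-0 (x ∷ xs) = ∑-0 xs

∑-distrib-+ : ∀ (xs : List A) f g → ∑[ x ∈ xs ] (f x + g x) ≡ ∑ xs f + ∑ xs g
∑-distrib-+ [] f g = refl
∑-distrib-+ (x ∷ xs) f g =
  trans (cong (f x + g x +_) (∑-distrib-+ xs f g)) (+-interchange (f x) (g x) (∑ xs f) (∑ xs g))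

*-distribˡ-∑ : ∀ (xs : List A) c f → c * ∑ xs f ≡ ∑[ x ∈ xs ] c * f x
*-distribˡ-∑ [] c f = *-zeroʳ c
*-distribˡ-∑ (x ∷ xs) c f = trans (*-distribˡ-+ c (f x) (∑ xs f)) (cong (c * f x +_) (*-distribˡ-∑ xs c f))

*-distribʳ-∑ : ∀ (xs : List A) c f → ∑ xs f * c ≡ ∑[ x ∈ xs ] f x * c
*-distribʳ-∑ xs c f = trans (*-comm (∑ xs f) c) (trans (*-distribˡ-∑ xs c f) (∑-cong xs (λ x → *-comm c (f x))))

∑-comm : ∀ (xs : List A) (ys : List B) (g : A → B → ℕ) →
  ∑[ x ∈ xs ] ∑[ y ∈ ys ] g x y ≡ ∑[ y ∈ ys ] ∑[ x ∈ xs ] g x y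
∑-comm [] ys g = sym (∑-0 ys)
∑-comm (x ∷ xs) ys g =
  trans (cong (∑ ys (g x) +_) (∑-comm xs ys g)) (sym (∑-distrib-+ ys (g x) (λ y → ∑[ x′ ∈ xs ] g x′ y)))

length-filterᵇ : ∀ (P : A → Bool) xs → length (filterᵇ P xs) ≡ ∑[ x ∈ xs ] χ (P x)
length-filterᵇ P [] = refl
length-filterᵇ P (x ∷ xs) with P x
... | true = cong suc (length-filterᵇ P xs)
... | false = length-filterᵇ P xs

sum-map : ∀ (f : A → ℕ) xs → ListAction.sum (List.map f xs) ≡ ∑ xs f
sum-map f [] = refl
sum-map f (x ∷ xs) = cong (f x +_) (sum-map f xs)

∑-cartesianProduct : ∀ (xs : List A) (ys : List B) h →
  ∑ (cartesianProduct xs ys) h ≡ ∑[ x ∈ xs ] ∑[ y ∈ ys ] h (x , y)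
∑-cartesianProduct [] ys h = refl
∑-cartesianProduct (x ∷ xs) ys h = begin
  ∑ (List.map (x ,_) ys ++ cartesianProduct xs ys) h
    ≡⟨ ∑-++ (List.map (x ,_) ys) _ h ⟩
  ∑ (List.map (x ,_) ys) h + ∑ (cartesianProduct xs ys) h
    ≡⟨ cong₂ _+_ (∑-map ys (x ,_) h) (∑-cartesianProduct xs ys h) ⟩
  (∑[ y ∈ ys ] h (x , y)) + (∑[ x′ ∈ xs ] ∑[ y ∈ ys ] h (x′ , y))
    ∎

∑-allVecsOf-suc : ∀ (xs : List A) n F →
  ∑ (allVecsOf xs (suc n)) F ≡ ∑[ v ∈ allVecsOf xs n ] ∑[ a ∈ xs ] F (a ∷ v)
∑-allVecsOf-suc xs n F =
  trans (∑-concatMap (allVecsOf xs n) _ F) (∑-cong (allVecsOf xs n) (λ v → ∑-map xs (_∷ v) F))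

∑-allFin : ∀ n (f : Fin n → ℕ) → ∑ (allFin n) f ≡ ∑< n f
∑-allFin n f = go n id
  where
  go : ∀ n (g : Fin n → Fin _) → ∑ (List.tabulate g) f ≡ ∑< n (f ∘ g)
  go zero g = refl
  go (suc n) g = cong (f (g fzero) +_) (go n (g ∘ fsuc))

∑<-mono-≤ : ∀ n {f g : Fin n → ℕ} → (∀ i → f i ≤ g i) → ∑< n f ≤ ∑< n g
∑<-mono-≤ zero f≤g = z≤n
∑<-mono-≤ (suc n) f≤g = +-mono-≤ (f≤g fzero) (∑<-mono-≤ n (f≤g ∘ fsuc))

∑<-const : ∀ n c → ∑< n (λ _ → c) ≡ n * c
∑<-const zero c = refl
∑<-const (suc n) c = cong (c +_) (∑<-const n c)

∑<≡n⇒≡1 : ∀ n (g : Fin n → ℕ) → (∀ i → g i ≤ 1) → ∑< n g ≡ n → ∀ i → g i ≡ 1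
∑<≡n⇒≡1 (suc n) g g≤1 ∑≡n i with g i in gᵢ | g≤1 i
... | 1 | _ = refl
... | suc (suc _) | s≤s ()
... | 0 | _ = contradiction ∑≡n (<⇒≢ (s≤s ∑≤n))
  where
  ∑≤n : ∑< (suc n) g ≤ n
  ∑≤n = subst₂ _≤_
    (sym (trans (sum-remove {i = i} g) (cong (_+ ∑< n (g ∘ punchIn i)) gᵢ)))
    (trans (∑<-const n 1) (*-identityʳ n))
    (∑<-mono-≤ n (g≤1 ∘ punchIn i))

∑<-remove-≥ : ∀ n (c : Fin (suc n)) (f : Fin (suc n) → ℕ) {A B} → A ≤ f c → (∀ r → r ≢ c → B ≤ f r) →
  A + n * B ≤ ∑< (suc n) f
∑<-remove-≥ n c f {A} {B} A≤fc B≤f = subst (A + n * B ≤_) (sym (sum-remove {i = c} f))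
  (+-mono-≤ A≤fc (subst (_≤ ∑< n (f ∘ punchIn c)) (∑<-const n B)
    (∑<-mono-≤ n (λ r → B≤f (punchIn c r) (Finₚ.punchInᵢ≢i c r)))))

∑<-remove-≡ : ∀ n (c : Fin (suc n)) (f : Fin (suc n) → ℕ) {A B} → f c ≡ A → (∀ r → r ≢ c → f r ≡ B) →
  ∑< (suc n) f ≡ A + n * B
∑<-remove-≡ n c f {A} {B} fc≡A f≡B = begin
  ∑< (suc n) f                   ≡⟨ sum-remove {i = c} f ⟩
  f c + ∑< n (f ∘ punchIn c)     ≡⟨ cong₂ _+_ fc≡A (sum-cong-≗ (λ r → f≡B (punchIn c r) (Finₚ.punchInᵢ≢i c r))) ⟩
  A + ∑< n (λ _ → B)             ≡⟨ cong (A +_) (∑<-const n B) ⟩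
  A + n * B                      ∎

∑<-remove₂-≥ : ∀ n {c d : Fin (suc (suc n))} (f : Fin (suc (suc n)) → ℕ) {A B} → c ≢ d →
  A ≤ f c → (∀ r → r ≢ c → r ≢ d → B ≤ f r) → A + n * B ≤ ∑< (suc (suc n)) f
∑<-remove₂-≥ n {c} {d} f {A} {B} c≢d A≤fc B≤f = subst (A + n * B ≤_) (sym (sum-remove {i = d} f))
  (≤-trans (∑<-remove-≥ n (punchOut (c≢d ∘ sym)) (f ∘ punchIn d) c′≥A rest≥B) (m≤n+m _ (f d)))
  where
  c′≥A : A ≤ f (punchIn d (punchOut (c≢d ∘ sym)))
  c′≥A = subst (λ x → A ≤ f x) (sym (Finₚ.punchIn-punchOut (c≢d ∘ sym))) A≤fc
  rest≥B : ∀ r → r ≢ punchOut (c≢d ∘ sym) → B ≤ f (punchIn d r)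
  rest≥B r r≢c′ = B≤f (punchIn d r)
    (λ e → r≢c′ (Finₚ.punchIn-injective d r _ (trans e (sym (Finₚ.punchIn-punchOut (c≢d ∘ sym))))))
    (Finₚ.punchInᵢ≢i d r)

∑<-remove₂-≡ : ∀ n {c d : Fin (suc (suc n))} (f : Fin (suc (suc n)) → ℕ) {A C B} → c ≢ d →
  f c ≡ A → f d ≡ C → (∀ r → r ≢ c → r ≢ d → f r ≡ B) → ∑< (suc (suc n)) f ≡ A + (C + n * B)
∑<-remove₂-≡ n {c} {d} f {A} {C} {B} c≢d fc≡A fd≡C f≡B = begin
  ∑< (suc (suc n)) f
    ≡⟨ sum-remove {i = c} f ⟩
  f c + ∑< (suc n) (f ∘ punchIn c)
    ≡⟨ cong₂ _+_ fc≡A (∑<-remove-≡ n (punchOut c≢d) (f ∘ punchIn c) d′≡C rest≡B) ⟩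
  A + (C + n * B)
    ∎
  where
  d′≡C : f (punchIn c (punchOut c≢d)) ≡ C
  d′≡C = trans (cong f (Finₚ.punchIn-punchOut c≢d)) fd≡C
  rest≡B : ∀ r → r ≢ punchOut c≢d → f (punchIn c r) ≡ B
  rest≡B r r≢d′ = f≡B (punchIn c r) (Finₚ.punchInᵢ≢i c r)
    (λ e → r≢d′ (Finₚ.punchIn-injective c r _ (trans e (sym (Finₚ.punchIn-punchOut c≢d)))))

prodFin-cong : ∀ n {f g : Fin n → ℕ} → (∀ i → f i ≡ g i) → prodFin n f ≡ prodFin n g
prodFin-cong zero f≗g = refl
prodFin-cong (suc n) f≗g = cong₂ _*_ (f≗g fzero) (prodFin-cong n (f≗g ∘ fsuc))

prodFin-mono-≤ : ∀ n {f g : Fin n → ℕ} → (∀ i → f i ≤ g i) → prodFin n f ≤ prodFin n g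
prodFin-mono-≤ zero f≤g = ≤-refl
prodFin-mono-≤ (suc n) f≤g = *-mono-≤ (f≤g fzero) (prodFin-mono-≤ n (f≤g ∘ fsuc))

prodFin-scale : ∀ n c (f : Fin n → ℕ) → prodFin n (λ i → c * f i) ≡ c ^ n * prodFin n f
prodFin-scale zero c f = refl
prodFin-scale (suc n) c f = trans (cong (c * f fzero *_) (prodFin-scale n c (f ∘ fsuc)))
  ([m*n]*[o*p]≡[m*o]*[n*p] c (f fzero) (c ^ n) (prodFin n (f ∘ fsuc)))

𝟙[_] : {P : Set} → Dec P → ℕ
𝟙[ p? ] = χ (does p?)

IsEnumeration : DecidableEquality A → List A → Set
IsEnumeration _≟_ xs = ∀ a → ∑[ x ∈ xs ] 𝟙[ x ≟ a ] ≡ 1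

∑-select : ∀ (_≟_ : DecidableEquality A) xs → IsEnumeration _≟_ xs →
  ∀ a (h : A → ℕ) → ∑[ x ∈ xs ] 𝟙[ x ≟ a ] * h x ≡ h a
∑-select _≟_ xs enum a h = begin
  ∑[ x ∈ xs ] 𝟙[ x ≟ a ] * h x   ≡⟨ ∑-cong xs select ⟩
  ∑[ x ∈ xs ] 𝟙[ x ≟ a ] * h a   ≡⟨ *-distribʳ-∑ xs (h a) _ ⟨
  (∑[ x ∈ xs ] 𝟙[ x ≟ a ]) * h a ≡⟨ cong (_* h a) (enum a) ⟩
  1 * h a                         ≡⟨ *-identityˡ (h a) ⟩
  h a                             ∎
  where
  select : ∀ x → 𝟙[ x ≟ a ] * h x ≡ 𝟙[ x ≟ a ] * h a
  select x with x ≟ a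
  ... | yes refl = refl
  ... | no _ = refl

-- Double counting the pairs (x, y) with x ≡ ι y.
∑-injection : ∀ (_≟A_ : DecidableEquality A) (_≟B_ : DecidableEquality B) xs ys →
  IsEnumeration _≟A_ xs → IsEnumeration _≟B_ ys →
  (ι : B → A) → Injective _≡_ _≡_ ι → (h : A → ℕ) → (∀ x → h x ≢ 0 → Σ B λ y → ι y ≡ x) →
  ∑ xs h ≡ ∑[ y ∈ ys ] h (ι y)
∑-injection _≟A_ _≟B_ xs ys enumA enumB ι ι-injective h support = begin
  ∑ xs h                                           ≡⟨ ∑-cong xs (λ x → sym (preimages x)) ⟩
  ∑[ x ∈ xs ] (∑[ y ∈ ys ] 𝟙[ x ≟A ι y ]) * h x    ≡⟨ ∑-cong xs (λ x → *-distribʳ-∑ ys (h x) _) ⟩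
  ∑[ x ∈ xs ] ∑[ y ∈ ys ] 𝟙[ x ≟A ι y ] * h x      ≡⟨ ∑-comm xs ys _ ⟩
  ∑[ y ∈ ys ] ∑[ x ∈ xs ] 𝟙[ x ≟A ι y ] * h x      ≡⟨ ∑-cong ys (λ y → ∑-select _≟A_ xs enumA (ι y) h) ⟩
  ∑[ y ∈ ys ] h (ι y)                              ∎
  where
  preimages : ∀ x → (∑[ y ∈ ys ] 𝟙[ x ≟A ι y ]) * h x ≡ h x
  preimages x with h x ℕ.≟ 0
  ... | yes hx≡0 =
    subst (λ k → (∑[ y ∈ ys ] 𝟙[ x ≟A ι y ]) * k ≡ k) (sym hx≡0) (*-zeroʳ (∑[ y ∈ ys ] 𝟙[ x ≟A ι y ]))
  ... | no hx≢0 with support x hx≢0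
  ... | y₀ , refl = trans (cong (_* h (ι y₀)) (trans (∑-cong ys unique) (enumB y₀))) (*-identityˡ _)
    where
    unique : ∀ y → 𝟙[ ι y₀ ≟A ι y ] ≡ 𝟙[ y ≟B y₀ ]
    unique y = cong χ (does-⇔ (mk⇔ (sym ∘ ι-injective) (λ { refl → refl })) (ι y₀ ≟A ι y) (y ≟B y₀))

allFin-isEnumeration : ∀ n → IsEnumeration _≟_ (allFin n)
allFin-isEnumeration (suc n) a = begin
  ∑[ x ∈ allFin (suc n) ] 𝟙[ x ≟ a ]
    ≡⟨ ∑-allFin (suc n) _ ⟩
  ∑< (suc n) (λ x → 𝟙[ x ≟ a ])
    ≡⟨ sum-remove {i = a} (λ x → 𝟙[ x ≟ a ]) ⟩
  𝟙[ a ≟ a ] + ∑< n (λ r → 𝟙[ punchIn a r ≟ a ])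
    ≡⟨ cong₂ _+_ (cong χ (dec-true (a ≟ a) refl)) (sum-cong-≗ punchIn≢a) ⟩
  1 + ∑< n (λ _ → 0)
    ≡⟨ cong suc (sum-replicate-zero n) ⟩
  1 ∎
  where
  punchIn≢a : ∀ r → 𝟙[ punchIn a r ≟ a ] ≡ 0
  punchIn≢a r = cong χ (dec-false (punchIn a r ≟ a) (Finₚ.punchInᵢ≢i a r))

isEnumeration-pairing : ∀ (_≟A_ : DecidableEquality A) (_≟B_ : DecidableEquality B) (_≟C_ : DecidableEquality C)
  (xs : List A) (ys : List B) (zs : List C) (pair : A → B → C) →
  (∀ {x y a b} → pair x y ≡ pair a b ⇔ (x ≡ a × y ≡ b)) →
  (∀ F → ∑ zs F ≡ ∑[ x ∈ xs ] ∑[ y ∈ ys ] F (pair x y)) →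
  IsEnumeration _≟A_ xs → IsEnumeration _≟B_ ys → ∀ a b → ∑[ z ∈ zs ] 𝟙[ z ≟C pair a b ] ≡ 1
isEnumeration-pairing _≟A_ _≟B_ _≟C_ xs ys zs pair pair-injective ∑-zs enumA enumB a b = begin
  ∑[ z ∈ zs ] 𝟙[ z ≟C pair a b ]
    ≡⟨ ∑-zs _ ⟩
  ∑[ x ∈ xs ] ∑[ y ∈ ys ] 𝟙[ pair x y ≟C pair a b ]
    ≡⟨ ∑-cong xs (λ x → ∑-cong ys (λ y → split x y)) ⟩
  ∑[ x ∈ xs ] ∑[ y ∈ ys ] 𝟙[ x ≟A a ] * 𝟙[ y ≟B b ]
    ≡⟨ ∑-cong xs (λ x → *-distribˡ-∑ ys (𝟙[ x ≟A a ]) _) ⟨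
  ∑[ x ∈ xs ] 𝟙[ x ≟A a ] * (∑[ y ∈ ys ] 𝟙[ y ≟B b ])
    ≡⟨ ∑-select _≟A_ xs enumA a (λ _ → ∑[ y ∈ ys ] 𝟙[ y ≟B b ]) ⟩
  ∑[ y ∈ ys ] 𝟙[ y ≟B b ]
    ≡⟨ enumB b ⟩
  1 ∎
  where
  split : ∀ x y → 𝟙[ pair x y ≟C pair a b ] ≡ 𝟙[ x ≟A a ] * 𝟙[ y ≟B b ]
  split x y = trans (cong χ (does-⇔ pair-injective (pair x y ≟C pair a b) ((x ≟A a) ×-dec (y ≟B b))))
    (χ-∧ (does (x ≟A a)) _)

cartesianProduct-isEnumeration : ∀ {_≟A_ : DecidableEquality A} {_≟B_ : DecidableEquality B} xs ys →
  IsEnumeration _≟A_ xs → IsEnumeration _≟B_ ys →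
  IsEnumeration (Productₚ.≡-dec _≟A_ _≟B_) (cartesianProduct xs ys)
cartesianProduct-isEnumeration {_≟A_ = _≟A_} {_≟B_} xs ys enumA enumB (a , b) =
  isEnumeration-pairing _≟A_ _≟B_ (Productₚ.≡-dec _≟A_ _≟B_) xs ys (cartesianProduct xs ys) _,_
    (mk⇔ (λ { refl → refl , refl }) (λ { (refl , refl) → refl }))
    (∑-cartesianProduct xs ys) enumA enumB a b

allVecsOf-isEnumeration : ∀ {_≟_ : DecidableEquality A} {xs} → IsEnumeration _≟_ xs →
  ∀ n → IsEnumeration (Vecₚ.≡-dec _≟_) (allVecsOf xs n)
allVecsOf-isEnumeration enum zero [] = refl
allVecsOf-isEnumeration {_≟_ = _≟_} {xs} enum (suc n) (a ∷ v) =
  isEnumeration-pairing (Vecₚ.≡-dec _≟_) _≟_ (Vecₚ.≡-dec _≟_)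
    (allVecsOf xs n) xs (allVecsOf xs (suc n)) (λ w b → b ∷ w)
    (mk⇔ (λ { refl → refl , refl }) (λ { (refl , refl) → refl }))
    (∑-allVecsOf-suc xs n) (allVecsOf-isEnumeration {_≟_ = _≟_} enum n) enum v a

χ-cong : ∀ {a b} → (a ≡ true ⇔ b ≡ true) → χ a ≡ χ b
χ-cong {true} {true} _ = refl
χ-cong {true} {false} a⇔b = contradiction (Equivalence.to a⇔b refl) λ ()
χ-cong {false} {true} a⇔b = contradiction (Equivalence.from a⇔b refl) λ ()
χ-cong {false} {false} _ = refl

not∧≡true⇔ : ∀ {a b} → not a ∧ b ≡ true ⇔ (a ≡ false × b ≡ true)
not∧≡true⇔ {false} = mk⇔ (refl ,_) proj₂
not∧≡true⇔ {true} = mk⇔ (λ ()) (λ ())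

allᶠ : ∀ n → (Fin n → Bool) → Bool
allᶠ zero p = true
allᶠ (suc n) p = p fzero ∧ allᶠ n (p ∘ fsuc)

χ-allᶠ : ∀ n p → χ (allᶠ n p) ≡ prodFin n (χ ∘ p)
χ-allᶠ zero p = refl
χ-allᶠ (suc n) p = trans (χ-∧ (p fzero) _) (cong (χ (p fzero) *_) (χ-allᶠ n (p ∘ fsuc)))

allᶠ≡true⇔ : ∀ n (p : Fin n → Bool) → allᶠ n p ≡ true ⇔ (∀ i → p i ≡ true)
allᶠ≡true⇔ zero p = mk⇔ (λ _ ()) (λ _ → refl)
allᶠ≡true⇔ (suc n) p with p fzero in p₀
... | true = mk⇔ (λ { ok fzero → p₀ ; ok (fsuc i) → Equivalence.to (allᶠ≡true⇔ n (p ∘ fsuc)) ok i })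
                 (λ ok → Equivalence.from (allᶠ≡true⇔ n (p ∘ fsuc)) (ok ∘ fsuc))
... | false = mk⇔ (λ ()) (λ ok → trans (sym p₀) (ok fzero))

T-all-allFin : ∀ n (p : Fin n → Bool) → T (all p (allFin n)) ⇔ (∀ i → T (p i))
T-all-allFin n p = mk⇔ (Allₚ.tabulate⁻ ∘ Allₚ.all⁺ p (allFin n)) (Allₚ.all⁻ p ∘ Allₚ.tabulate⁺)

-- H-colorings as color vectors

allBoolVecs≡allVecsOf : ∀ n → allBoolVecs n ≡ allVecsOf (false ∷ true ∷ []) n
allBoolVecs≡allVecsOf zero = refl
allBoolVecs≡allVecsOf (suc n) = cong (concatMap _) (allBoolVecs≡allVecsOf n)

allHSubsets-isEnumeration : ∀ V m → IsEnumeration (Vecₚ.≡-dec (Vecₚ.≡-dec Boolₚ._≟_)) (allHSubsets V m)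
allHSubsets-isEnumeration V m = allVecsOf-isEnumeration allBoolVecs-isEnumeration V
  where
  bools-isEnumeration : IsEnumeration Boolₚ._≟_ (false ∷ true ∷ [])
  bools-isEnumeration false = refl
  bools-isEnumeration true = refl
  allBoolVecs-isEnumeration : IsEnumeration (Vecₚ.≡-dec Boolₚ._≟_) (allBoolVecs m)
  allBoolVecs-isEnumeration rewrite allBoolVecs≡allVecsOf m = allVecsOf-isEnumeration bools-isEnumeration m

lookup-⁅⁆ : ∀ {m} (i j : Fin m) → lookup ⁅ i ⁆ j ≡ true → j ≡ i
lookup-⁅⁆ i j e = x∈⁅y⁆⇒x≡y i (Vecₚ.lookup⇒[]= j ⁅ i ⁆ e)

lookup-⁅⁆-self : ∀ {m} (i : Fin m) → lookup ⁅ i ⁆ i ≡ true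
lookup-⁅⁆-self i = Vecₚ.[]=⇒lookup (x∈⁅x⁆ i)

⁅⁆-injective : ∀ {m} → Injective _≡_ _≡_ (⁅_⁆ {m})
⁅⁆-injective {x = i} {j} e = lookup-⁅⁆ j i (subst (λ r → lookup r i ≡ true) e (lookup-⁅⁆-self i))

map-injective : ∀ {B : Set} {f : A → B} {n} → Injective _≡_ _≡_ f → Injective _≡_ _≡_ (map {n = n} f)
map-injective f-inj {[]} {[]} _ = refl
map-injective f-inj {x ∷ xs} {y ∷ ys} e =
  cong₂ _∷_ (f-inj (Vecₚ.∷-injectiveˡ e)) (map-injective f-inj (Vecₚ.∷-injectiveʳ e))

rowSize : ∀ {m} → Vec Bool m → ℕ
rowSize {m} r = ∑< m (λ i → χ (lookup r i))

rowSize-∅ : ∀ m → rowSize (∅ {m}) ≡ 0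
rowSize-∅ zero = refl
rowSize-∅ (suc m) = rowSize-∅ m

rowSize-⁅⁆ : ∀ {m} (i : Fin m) → rowSize ⁅ i ⁆ ≡ 1
rowSize-⁅⁆ {suc m} fzero = cong suc (rowSize-∅ m)
rowSize-⁅⁆ (fsuc i) = rowSize-⁅⁆ i

rowSize≡0⇒∅ : ∀ {m} (r : Vec Bool m) → rowSize r ≡ 0 → r ≡ ∅
rowSize≡0⇒∅ [] _ = refl
rowSize≡0⇒∅ (false ∷ r) e = cong (false ∷_) (rowSize≡0⇒∅ r e)

rowSize≡1⇒⁅⁆ : ∀ {m} (r : Vec Bool m) → rowSize r ≡ 1 → ∃ λ i → r ≡ ⁅ i ⁆
rowSize≡1⇒⁅⁆ (true ∷ r) e = fzero , cong (true ∷_) (rowSize≡0⇒∅ r (suc-injective e))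
rowSize≡1⇒⁅⁆ (false ∷ r) e with rowSize≡1⇒⁅⁆ r e
... | i , r≡⁅i⁆ = fsuc i , cong (false ∷_) r≡⁅i⁆

rowSize≤1 : ∀ {m} (r : Vec Bool m) → (∀ i j → lookup r i ≡ true → lookup r j ≡ true → i ≡ j) → rowSize r ≤ 1
rowSize≤1 [] _ = z≤n
rowSize≤1 (false ∷ r) atMostOne = rowSize≤1 r (λ i j rᵢ rⱼ → Finₚ.suc-injective (atMostOne (fsuc i) (fsuc j) rᵢ rⱼ))
rowSize≤1 {suc m} (true ∷ r) atMostOne = ≤-reflexive (cong suc (trans (sum-cong-≗ rest-false) (sum-replicate-zero m)))
  where
  rest-false : ∀ j → χ (lookup r j) ≡ 0
  rest-false j with lookup r j in rⱼ
  ... | false = refl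
  ... | true = contradiction (atMostOne fzero (fsuc j) refl rⱼ) λ ()

size≡∑rowSize : ∀ {m V} (S : HSubset V m) → size S ≡ ∑< V (λ x → rowSize (lookup S x))
size≡∑rowSize {m} {V} S = begin
  size S
    ≡⟨ sum-map _ (allFin V) ⟩
  ∑[ x ∈ allFin V ] length (filterᵇ (mem S x) (allFin m))
    ≡⟨ ∑-allFin V _ ⟩
  ∑< V (λ x → length (filterᵇ (mem S x) (allFin m)))
    ≡⟨ sum-cong-≗ (λ x → trans (length-filterᵇ (mem S x) (allFin m)) (∑-allFin m _)) ⟩
  ∑< V (λ x → rowSize (lookup S x))
    ∎

module _ {G : Graph} {m : ℕ} (H : Cover G m) where

  IsIndependent : HSubset (V G) m → Set
  IsIndependent S = ∀ x i y j → mem S x i ≡ true → mem S y j ≡ true → adjH H x i y j ≡ false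

  IsProper : Vec (Fin m) (V G) → Set
  IsProper c = ∀ x y → adjH H x (lookup c x) y (lookup c y) ≡ false

  isIndependent⇔IsIndependent : ∀ S → isIndependent H S ≡ true ⇔ IsIndependent S
  isIndependent⇔IsIndependent S = mk⇔
    (λ e x i y j → to (nand′ x i y j) (to T-isIndependent⇔ (from Boolₚ.T-≡ e) x i y j))
    (λ ind → to Boolₚ.T-≡ (from T-isIndependent⇔ (λ x i y j → from (nand′ x i y j) (ind x i y j))))
    where
    open Equivalence
    nand : ∀ a b c → T (not (a ∧ b ∧ c)) ⇔ (a ≡ true → b ≡ true → c ≡ false)
    nand true true true = mk⇔ (λ ()) (λ f → contradiction (f refl refl) λ ())
    nand true true false = mk⇔ (λ _ _ _ → refl) _
    nand true false c = mk⇔ (λ _ _ ()) _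
    nand false b c = mk⇔ (λ _ ()) _
    nand′ : ∀ x i y j → T (not (mem S x i ∧ mem S y j ∧ adjH H x i y j)) ⇔
      (mem S x i ≡ true → mem S y j ≡ true → adjH H x i y j ≡ false)
    nand′ x i y j = nand (mem S x i) (mem S y j) (adjH H x i y j)
    T-isIndependent⇔ : T (isIndependent H S) ⇔ (∀ x i y j → T (not (mem S x i ∧ mem S y j ∧ adjH H x i y j)))
    T-isIndependent⇔ = mk⇔
      (λ t x i y j → to (T-all-allFin m _) (to (T-all-allFin (V G) _)
        (to (T-all-allFin m _) (to (T-all-allFin (V G) _) t x) i) y) j)
      (λ h → from (T-all-allFin (V G) _) λ x → from (T-all-allFin m _) λ i →
        from (T-all-allFin (V G) _) λ y → from (T-all-allFin m _) (h x i y))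

  private
    ∧≡true⇔ : ∀ {a b} → a ∧ b ≡ true ⇔ (a ≡ true × b ≡ true)
    ∧≡true⇔ {true} = mk⇔ (refl ,_) proj₂
    ∧≡true⇔ {false} = mk⇔ (λ ()) (λ ())

    mem-map-⁅⁆ : ∀ (c : Vec (Fin m) (V G)) x i → mem (map ⁅_⁆ c) x i ≡ lookup ⁅ lookup c x ⁆ i
    mem-map-⁅⁆ c x i = cong (λ r → lookup r i) (Vecₚ.lookup-map x ⁅_⁆ c)

  isHColoring⇒rows-⁅⁆ : ∀ S → isHColoring H S ≡ true → ∃ λ c → map ⁅_⁆ c ≡ S
  isHColoring⇒rows-⁅⁆ S e = tabulate colorOf , (begin
    map ⁅_⁆ (tabulate colorOf)   ≡⟨ Vecₚ.tabulate-∘ ⁅_⁆ colorOf ⟨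
    tabulate (⁅_⁆ ∘ colorOf)     ≡⟨ Vecₚ.tabulate-cong (λ x → sym (proj₂ (row-⁅⁆ x))) ⟩
    tabulate (lookup S)          ≡⟨ Vecₚ.tabulate∘lookup S ⟩
    S                            ∎)
    where
    independent : IsIndependent S
    independent = Equivalence.to (isIndependent⇔IsIndependent S) (proj₁ (Equivalence.to ∧≡true⇔ e))
    size≡V : ∑< (V G) (λ x → rowSize (lookup S x)) ≡ V G
    size≡V = trans (sym (size≡∑rowSize S))
      (≡ᵇ⇒≡ (size S) (V G) (Equivalence.from Boolₚ.T-≡ (proj₂ (Equivalence.to (∧≡true⇔ {isIndependent H S}) e))))
    rowSize≤1′ : ∀ x → rowSize (lookup S x) ≤ 1
    rowSize≤1′ x = rowSize≤1 (lookup S x) atMostOne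
      where
      atMostOne : ∀ i j → mem S x i ≡ true → mem S x j ≡ true → i ≡ j
      atMostOne i j Sxi Sxj with i ≟ j
      ... | yes i≡j = i≡j
      ... | no i≢j = contradiction (trans (sym (clique H x i j i≢j)) (independent x i x j Sxi Sxj)) λ ()
    row-⁅⁆ : ∀ x → ∃ λ i → lookup S x ≡ ⁅ i ⁆
    row-⁅⁆ x = rowSize≡1⇒⁅⁆ (lookup S x) (∑<≡n⇒≡1 (V G) _ rowSize≤1′ size≡V x)
    colorOf : Fin (V G) → Fin m
    colorOf x = proj₁ (row-⁅⁆ x)

  isHColoring⇔IsProper : ∀ c → isHColoring H (map ⁅_⁆ c) ≡ true ⇔ IsProper c
  isHColoring⇔IsProper c = mk⇔ to from
    where
    S : HSubset (V G) m
    S = map ⁅_⁆ c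
    S-self : ∀ x → mem S x (lookup c x) ≡ true
    S-self x = trans (mem-map-⁅⁆ c x _) (lookup-⁅⁆-self (lookup c x))
    to : isHColoring H S ≡ true → IsProper c
    to e x y = Equivalence.to (isIndependent⇔IsIndependent S) (proj₁ (Equivalence.to ∧≡true⇔ e))
      x (lookup c x) y (lookup c y) (S-self x) (S-self y)
    independent : IsProper c → IsIndependent S
    independent proper x i y j Sxi Syj
      rewrite lookup-⁅⁆ (lookup c x) i (trans (sym (mem-map-⁅⁆ c x i)) Sxi)
            | lookup-⁅⁆ (lookup c y) j (trans (sym (mem-map-⁅⁆ c y j)) Syj) = proper x y
    size≡V : size S ≡ V G
    size≡V = begin
      size S
        ≡⟨ size≡∑rowSize S ⟩
      ∑< (V G) (λ x → rowSize (lookup S x))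
        ≡⟨ sum-cong-≗ (λ x → trans (cong rowSize (Vecₚ.lookup-map x ⁅_⁆ c)) (rowSize-⁅⁆ (lookup c x))) ⟩
      ∑< (V G) (λ _ → 1)
        ≡⟨ ∑<-const (V G) 1 ⟩
      V G * 1
        ≡⟨ *-identityʳ (V G) ⟩
      V G ∎
    from : IsProper c → isHColoring H S ≡ true
    from proper = Equivalence.from ∧≡true⇔
      ( Equivalence.from (isIndependent⇔IsIndependent S) (independent proper)
      , Equivalence.to Boolₚ.T-≡ (≡⇒≡ᵇ (size S) (V G) size≡V))

  numColorings≡∑ : numColorings H ≡ ∑[ c ∈ allVecsOf (allFin m) (V G) ] χ (isHColoring H (map ⁅_⁆ c))
  numColorings≡∑ = trans (length-filterᵇ (isHColoring H) (allHSubsets (V G) m))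
    (∑-injection (Vecₚ.≡-dec (Vecₚ.≡-dec Boolₚ._≟_)) (Vecₚ.≡-dec _≟_) (allHSubsets (V G) m) (allVecsOf (allFin m) (V G))
      (allHSubsets-isEnumeration (V G) m) (allVecsOf-isEnumeration (allFin-isEnumeration m) (V G))
      (map ⁅_⁆) (map-injective ⁅⁆-injective) (χ ∘ isHColoring H) support)
    where
    support : ∀ S → χ (isHColoring H S) ≢ 0 → ∃ λ c → map ⁅_⁆ c ≡ S
    support S χ≢0 with isHColoring H S in e
    ... | true = isHColoring⇒rows-⁅⁆ S e
    ... | false = contradiction refl χ≢0

-- Odd cycles as paths

Pos : ℕ → Set
Pos K = Fin (suc (suc K))

last : ∀ {K} → Pos K
last {K} = fromℕ (suc K)

CycleStep : ∀ {K} → Pos K → Pos K → Set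
CycleStep {K} p q = (Σ (Fin (suc K)) λ t → p ≡ inject₁ t × q ≡ fsuc t) ⊎ (p ≡ last × q ≡ fzero)

CycleAdj : ∀ {K} → Pos K → Pos K → Set
CycleAdj p q = CycleStep p q ⊎ CycleStep q p

fromℕ-or-inject₁ : ∀ {n} (p : Fin (suc n)) → p ≡ fromℕ n ⊎ ∃ λ t → p ≡ inject₁ t
fromℕ-or-inject₁ {zero} fzero = inj₁ refl
fromℕ-or-inject₁ {suc n} fzero = inj₂ (fzero , refl)
fromℕ-or-inject₁ {suc n} (fsuc p) with fromℕ-or-inject₁ p
... | inj₁ refl = inj₁ refl
... | inj₂ (t , refl) = inj₂ (fsuc t , refl)

positionView : ∀ {K} (p : Pos K) → p ≡ fzero ⊎ p ≡ last ⊎ ∃ λ t → p ≡ fsuc (inject₁ t)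
positionView fzero = inj₁ refl
positionView (fsuc p) with fromℕ-or-inject₁ p
... | inj₁ refl = inj₂ (inj₁ refl)
... | inj₂ (t , refl) = inj₂ (inj₂ (t , refl))

cycleStep⇔suc% : ∀ {K} {p q : Pos K} → CycleStep p q ⇔ (suc (toℕ p) % suc (suc K) ≡ toℕ q)
cycleStep⇔suc% {K} {p} {q} = mk⇔ to from
  where
  L : ℕ
  L = suc (suc K)
  suc-inject₁ : ∀ (t : Fin (suc K)) → suc (toℕ (inject₁ t)) % L ≡ toℕ (fsuc {suc K} t)
  suc-inject₁ t = trans (cong (λ n → suc n % L) (Finₚ.toℕ-inject₁ t)) (m<n⇒m%n≡m (s≤s (Finₚ.toℕ<n t)))
  suc-last : suc (toℕ (last {K})) % L ≡ 0
  suc-last = trans (cong (λ n → suc n % L) (Finₚ.toℕ-fromℕ (suc K))) (n%n≡0 L)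
  to : CycleStep p q → suc (toℕ p) % L ≡ toℕ q
  to (inj₁ (t , refl , refl)) = suc-inject₁ t
  to (inj₂ (refl , refl)) = suc-last
  from : suc (toℕ p) % L ≡ toℕ q → CycleStep p q
  from e with fromℕ-or-inject₁ p
  ... | inj₁ refl = inj₂ (refl , Finₚ.toℕ-injective (trans (sym e) suc-last))
  ... | inj₂ (t , refl) = inj₁ (t , refl , Finₚ.toℕ-injective (trans (sym e) (suc-inject₁ t)))

cycleStep-fzero : ∀ {K} {p : Pos K} → CycleStep p fzero → p ≡ last
cycleStep-fzero (inj₂ (p≡last , _)) = p≡last

opposite-inject₁ : ∀ {n} (t : Fin (suc n)) → opposite (inject₁ t) ≡ fsuc (opposite t)
opposite-inject₁ fzero = refl
opposite-inject₁ {suc n} (fsuc t) = cong inject₁ (opposite-inject₁ t)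

opposite-fromℕ : ∀ n → opposite (fromℕ n) ≡ fzero
opposite-fromℕ zero = refl
opposite-fromℕ (suc n) = cong inject₁ (opposite-fromℕ n)

opposite-cycleStep : ∀ {K} {p q : Pos K} → CycleStep p q → CycleStep (opposite q) (opposite p)
opposite-cycleStep (inj₁ (t , refl , refl)) = inj₁ (opposite t , refl , opposite-inject₁ t)
opposite-cycleStep {K} (inj₂ (refl , refl)) = inj₂ (refl , opposite-fromℕ (suc K))

module Rotation (K : ℕ) where

  L : ℕ
  L = suc (suc K)

  rotate : ℕ → Pos K → Pos K
  rotate r p = fromℕ< (m%n<n (toℕ p + r) L)

  toℕ-rotate : ∀ r p → toℕ (rotate r p) ≡ (toℕ p + r) % L
  toℕ-rotate r p = Finₚ.toℕ-fromℕ< (m%n<n (toℕ p + r) L)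

  [m%L+n]%L≡[m+n]%L : ∀ m n → (m % L + n) % L ≡ (m + n) % L
  [m%L+n]%L≡[m+n]%L m n = begin
    (m % L + n) % L         ≡⟨ %-distribˡ-+ (m % L) n L ⟩
    (m % L % L + n % L) % L ≡⟨ cong (λ k → (k + n % L) % L) (m%n%n≡m%n m L) ⟩
    (m % L + n % L) % L     ≡⟨ %-distribˡ-+ m n L ⟨
    (m + n) % L             ∎

  rotate-inverse : ∀ r s → (r + s) % L ≡ 0 → ∀ p → rotate s (rotate r p) ≡ p
  rotate-inverse r s r+s≡0 p = Finₚ.toℕ-injective (begin
    toℕ (rotate s (rotate r p))     ≡⟨ toℕ-rotate s (rotate r p) ⟩
    (toℕ (rotate r p) + s) % L      ≡⟨ cong (λ k → (k + s) % L) (toℕ-rotate r p) ⟩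
    ((toℕ p + r) % L + s) % L       ≡⟨ [m%L+n]%L≡[m+n]%L (toℕ p + r) s ⟩
    (toℕ p + r + s) % L             ≡⟨ cong (_% L) (+-assoc (toℕ p) r s) ⟩
    (toℕ p + (r + s)) % L           ≡⟨ cong (_% L) (+-comm (toℕ p) (r + s)) ⟩
    (r + s + toℕ p) % L             ≡⟨ [m%L+n]%L≡[m+n]%L (r + s) (toℕ p) ⟨
    ((r + s) % L + toℕ p) % L       ≡⟨ cong (λ k → (k + toℕ p) % L) r+s≡0 ⟩
    toℕ p % L                       ≡⟨ m<n⇒m%n≡m (Finₚ.toℕ<n p) ⟩
    toℕ p                           ∎)

  rotate-cycleStep : ∀ r {p q} → CycleStep p q → CycleStep (rotate r p) (rotate r q)
  rotate-cycleStep r {p} {q} step = Equivalence.from cycleStep⇔suc% (begin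
    suc (toℕ (rotate r p)) % L     ≡⟨ cong (λ k → suc k % L) (toℕ-rotate r p) ⟩
    suc ((toℕ p + r) % L) % L      ≡⟨ cong (_% L) (+-comm 1 ((toℕ p + r) % L)) ⟩
    ((toℕ p + r) % L + 1) % L      ≡⟨ [m%L+n]%L≡[m+n]%L (toℕ p + r) 1 ⟩
    (toℕ p + r + 1) % L            ≡⟨ cong (_% L) (+-comm (toℕ p + r) 1) ⟩
    (suc (toℕ p) + r) % L          ≡⟨ [m%L+n]%L≡[m+n]%L (suc (toℕ p)) r ⟨
    (suc (toℕ p) % L + r) % L      ≡⟨ cong (λ k → (k + r) % L) (Equivalence.to cycleStep⇔suc% step) ⟩
    (toℕ q + r) % L                ≡⟨ toℕ-rotate r q ⟨
    toℕ (rotate r q)               ∎)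

  rotate-to-fzero : ∀ c → rotate (L ∸ toℕ c) c ≡ fzero
  rotate-to-fzero c = Finₚ.toℕ-injective (begin
    toℕ (rotate (L ∸ toℕ c) c)     ≡⟨ toℕ-rotate (L ∸ toℕ c) c ⟩
    (toℕ c + (L ∸ toℕ c)) % L      ≡⟨ cong (_% L) (m+[n∸m]≡n (<⇒≤ (Finₚ.toℕ<n c))) ⟩
    L % L                          ≡⟨ n%n≡0 L ⟩
    0                              ∎)

rotate-cycleAdj : ∀ {K} r {p q : Pos K} → CycleAdj p q → CycleAdj (Rotation.rotate K r p) (Rotation.rotate K r q)
rotate-cycleAdj {K} r (inj₁ step) = inj₁ (Rotation.rotate-cycleStep K r step)
rotate-cycleAdj {K} r (inj₂ step) = inj₂ (Rotation.rotate-cycleStep K r step)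

opposite-cycleAdj : ∀ {K} {p q : Pos K} → CycleAdj p q → CycleAdj (opposite p) (opposite q)
opposite-cycleAdj (inj₁ step) = inj₂ (opposite-cycleStep step)
opposite-cycleAdj (inj₂ step) = inj₁ (opposite-cycleStep step)

cycAdj⇔CycleAdj : ∀ k {p q : Pos (suc k)} → cycAdj k p q ⇔ CycleAdj p q
cycAdj⇔CycleAdj k = mk⇔
  (λ { (inj₁ e) → inj₁ (Equivalence.from cycleStep⇔suc% e) ; (inj₂ e) → inj₂ (Equivalence.from cycleStep⇔suc% e) })
  (λ { (inj₁ s) → inj₁ (Equivalence.to cycleStep⇔suc% s) ; (inj₂ s) → inj₂ (Equivalence.to cycleStep⇔suc% s) })

record CycleSymmetry (K : ℕ) (a b : Pos K) : Set where
  field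
    σ τ   : Pos K → Pos K
    τ∘σ   : ∀ p → τ (σ p) ≡ p
    σ∘τ   : ∀ p → σ (τ p) ≡ p
    σ-adj : ∀ {p q} → CycleAdj p q → CycleAdj (σ p) (σ q)
    τ-adj : ∀ {p q} → CycleAdj p q → CycleAdj (τ p) (τ q)
    σ-a   : σ a ≡ fzero
    σ-b   : σ b ≡ last

rotationSymmetry : ∀ {K} {a b : Pos K} → CycleStep b a → CycleSymmetry K a b
rotationSymmetry {K} {a} {b} b→a = record
  { σ = rotate (L ∸ toℕ a) ; τ = rotate (toℕ a)
  ; τ∘σ = rotate-inverse (L ∸ toℕ a) (toℕ a) (L∸c+c≡0 a)
  ; σ∘τ = rotate-inverse (toℕ a) (L ∸ toℕ a) (c+L∸c≡0 a)
  ; σ-adj = rotate-cycleAdj (L ∸ toℕ a) ; τ-adj = rotate-cycleAdj (toℕ a)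
  ; σ-a = rotate-to-fzero a
  ; σ-b = cycleStep-fzero (subst (CycleStep _) (rotate-to-fzero a) (rotate-cycleStep (L ∸ toℕ a) b→a))
  }
  where
  open Rotation K
  c≤L : ∀ (c : Pos K) → toℕ c ≤ L
  c≤L c = <⇒≤ (Finₚ.toℕ<n c)
  L∸c+c≡0 : ∀ (c : Pos K) → (L ∸ toℕ c + toℕ c) % L ≡ 0
  L∸c+c≡0 c = trans (cong (_% L) (m∸n+n≡m (c≤L c))) (n%n≡0 L)
  c+L∸c≡0 : ∀ (c : Pos K) → (toℕ c + (L ∸ toℕ c)) % L ≡ 0
  c+L∸c≡0 c = trans (cong (_% L) (m+[n∸m]≡n (c≤L c))) (n%n≡0 L)

-- A rotation takes the edge {a, b} to {last, 0}; if it lands with a at last, the reflection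
-- opposite swaps the two ends.
cycleSymmetry : ∀ {K} {a b : Pos K} → CycleAdj a b → CycleSymmetry K a b
cycleSymmetry (inj₂ b→a) = rotationSymmetry b→a
cycleSymmetry {K} {a} {b} (inj₁ a→b) = record
  { σ = opposite ∘ σ ; τ = τ ∘ opposite
  ; τ∘σ = λ p → trans (cong τ (Finₚ.opposite-involutive (σ p))) (τ∘σ p)
  ; σ∘τ = λ p → trans (cong opposite (σ∘τ (opposite p))) (Finₚ.opposite-involutive p)
  ; σ-adj = opposite-cycleAdj ∘ σ-adj ; τ-adj = τ-adj ∘ opposite-cycleAdj
  ; σ-a = trans (cong opposite σa≡last) (opposite-fromℕ (suc K))
  ; σ-b = cong opposite σ-a
  }
  where
  open CycleSymmetry (rotationSymmetry {K} {b} {a} a→b)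
  σa≡last : σ a ≡ last
  σa≡last = cycleStep-fzero (subst (CycleStep _) σ-a (Rotation.rotate-cycleStep K _ a→b))

-- The cycle read as the path vert 0 = u, …, vert last = v with K interior vertices,
-- closed by the edge uv.
record CyclePath (Gi : Graph) (u v : Fin (V Gi)) : Set where
  field
    K k          : ℕ
    K≡1+k+k      : K ≡ suc (k + k)
    pos          : Fin (V Gi) → Pos K
    vert         : Pos K → Fin (V Gi)
    pos-vert     : ∀ p → pos (vert p) ≡ p
    vert-pos     : ∀ x → vert (pos x) ≡ x
    pos-u        : pos u ≡ fzero
    pos-v        : pos v ≡ last
    adj⇒cycleAdj : ∀ x y → adj Gi x y ≡ true → CycleAdj (pos x) (pos y)
    path-adj     : ∀ t → adj Gi (vert (inject₁ t)) (vert (fsuc t)) ≡ true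
    adj-u-v      : adj Gi u v ≡ true

oddCycle⇒cyclePath : ∀ {Gi : Graph} {u v} → IsOddCycle Gi → adj Gi u v ≡ true → CyclePath Gi u v
oddCycle⇒cyclePath {Gi} {u} {v} (k , f , (f-injective , f-surjective) , f-adj) uv = record
  { K = suc (k + k) ; k = k ; K≡1+k+k = refl
  ; pos = σ ∘ f ; vert = f⁻¹ ∘ τ
  ; pos-vert = λ p → trans (cong σ (f∘f⁻¹ (τ p))) (σ∘τ p)
  ; vert-pos = λ x → trans (cong f⁻¹ (τ∘σ (f x))) (f⁻¹∘f x)
  ; pos-u = σ-a ; pos-v = σ-b
  ; adj⇒cycleAdj = λ x y → σ-adj ∘ adj⇒CycleAdj x y
  ; adj-u-v = uv
  ; path-adj = λ t → CycleAdj⇒adj _ _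
      (subst₂ CycleAdj (sym (f∘f⁻¹ _)) (sym (f∘f⁻¹ _)) (τ-adj (inj₁ (inj₁ (t , refl , refl)))))
  }
  where
  adj⇒CycleAdj : ∀ x y → adj Gi x y ≡ true → CycleAdj (f x) (f y)
  adj⇒CycleAdj x y = Equivalence.to (cycAdj⇔CycleAdj (k + k)) ∘ proj₁ (f-adj x y)
  CycleAdj⇒adj : ∀ x y → CycleAdj (f x) (f y) → adj Gi x y ≡ true
  CycleAdj⇒adj x y = proj₂ (f-adj x y) ∘ Equivalence.from (cycAdj⇔CycleAdj (k + k))
  open CycleSymmetry (cycleSymmetry (adj⇒CycleAdj u v uv))
  f⁻¹ : Pos (suc (k + k)) → Fin (V Gi)
  f⁻¹ p = proj₁ (f-surjective p)
  f∘f⁻¹ : ∀ p → f (f⁻¹ p) ≡ p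
  f∘f⁻¹ p = proj₂ (f-surjective p) refl
  f⁻¹∘f : ∀ x → f⁻¹ (f x) ≡ x
  f⁻¹∘f x = f-injective (f∘f⁻¹ (f x))

module _ {Gi : Graph} {u v : Fin (V Gi)} (cp : CyclePath Gi u v) where

  open CyclePath cp

  vert-zero : vert fzero ≡ u
  vert-zero = trans (cong vert (sym pos-u)) (vert-pos u)

  vert-last : vert last ≡ v
  vert-last = trans (cong vert (sym pos-v)) (vert-pos v)

-- Π (i : Fin n), Vec A (K i) as nested pairs, so that it can be enumerated.
Vecs : Set → (n : ℕ) → (Fin n → ℕ) → Set
Vecs A zero K = ⊤
Vecs A (suc n) K = Vec A (K fzero) × Vecs A n (K ∘ fsuc)

lookupᵛ : ∀ {n K} → Vecs A n K → (i : Fin n) → Vec A (K i)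
lookupᵛ {n = suc n} (d , ds) fzero = d
lookupᵛ {n = suc n} (d , ds) (fsuc i) = lookupᵛ ds i

tabulateᵛ : ∀ {n K} → ((i : Fin n) → Vec A (K i)) → Vecs A n K
tabulateᵛ {n = zero} f = tt
tabulateᵛ {n = suc n} f = f fzero , tabulateᵛ (f ∘ fsuc)

lookupᵛ∘tabulateᵛ : ∀ {n K} (f : (i : Fin n) → Vec A (K i)) i → lookupᵛ {K = K} (tabulateᵛ f) i ≡ f i
lookupᵛ∘tabulateᵛ f fzero = refl
lookupᵛ∘tabulateᵛ f (fsuc i) = lookupᵛ∘tabulateᵛ (f ∘ fsuc) i

tabulateᵛ∘lookupᵛ : ∀ {n K} (ds : Vecs A n K) → tabulateᵛ (lookupᵛ ds) ≡ ds
tabulateᵛ∘lookupᵛ {n = zero} tt = refl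
tabulateᵛ∘lookupᵛ {n = suc n} (d , ds) = cong (d ,_) (tabulateᵛ∘lookupᵛ ds)

tabulateᵛ-cong : ∀ {n K} {f g : (i : Fin n) → Vec A (K i)} → (∀ i → f i ≡ g i) → tabulateᵛ {K = K} f ≡ tabulateᵛ g
tabulateᵛ-cong {n = zero} f≗g = refl
tabulateᵛ-cong {n = suc n} f≗g = cong₂ _,_ (f≗g fzero) (tabulateᵛ-cong (f≗g ∘ fsuc))

≡-decᵛ : DecidableEquality A → ∀ {n K} → DecidableEquality (Vecs A n K)
≡-decᵛ _≟_ {n = zero} tt tt = yes refl
≡-decᵛ _≟_ {n = suc n} = Productₚ.≡-dec (Vecₚ.≡-dec _≟_) (≡-decᵛ _≟_)

allVecs : List A → ∀ n K → List (Vecs A n K)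
allVecs xs zero K = tt ∷ []
allVecs xs (suc n) K = cartesianProduct (allVecsOf xs (K fzero)) (allVecs xs n (K ∘ fsuc))

allVecs-isEnumeration : ∀ {_≟_ : DecidableEquality A} {xs} → IsEnumeration _≟_ xs →
  ∀ n K → IsEnumeration (≡-decᵛ _≟_ {n} {K}) (allVecs xs n K)
allVecs-isEnumeration enum zero K tt = refl
allVecs-isEnumeration {_≟_ = _≟_} {xs = xs} enum (suc n) K =
  cartesianProduct-isEnumeration {_≟A_ = Vecₚ.≡-dec _≟_} {_≟B_ = ≡-decᵛ _≟_}
    (allVecsOf xs (K fzero)) (allVecs xs n (K ∘ fsuc))
    (allVecsOf-isEnumeration enum (K fzero)) (allVecs-isEnumeration enum n (K ∘ fsuc))

∑-allVecs-prodFin : ∀ {A : Set} (xs : List A) n K (F : (i : Fin n) → Vec A (K i) → ℕ) →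
  ∑[ ds ∈ allVecs xs n K ] prodFin n (λ i → F i (lookupᵛ {K = K} ds i)) ≡
  prodFin n (λ i → ∑ (allVecsOf xs (K i)) (F i))
∑-allVecs-prodFin xs zero K F = refl
∑-allVecs-prodFin {A} xs (suc n) K F = begin
  ∑[ ds ∈ allVecs xs (suc n) K ] prodFin (suc n) (λ i → F i (lookupᵛ {K = K} ds i))
    ≡⟨ ∑-cartesianProduct Ds Dss _ ⟩
  ∑[ d ∈ Ds ] ∑[ ds ∈ Dss ] F fzero d * prodFin n (λ i → F (fsuc i) (lookupᵛ {K = K ∘ fsuc} ds i))
    ≡⟨ ∑-cong Ds (λ d → sym (*-distribˡ-∑ Dss (F fzero d) _)) ⟩
  ∑[ d ∈ Ds ] F fzero d * (∑[ ds ∈ Dss ] prodFin n (λ i → F (fsuc i) (lookupᵛ {K = K ∘ fsuc} ds i)))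
    ≡⟨ ∑-cong Ds (λ d → cong (F fzero d *_) (∑-allVecs-prodFin xs n (K ∘ fsuc) (F ∘ fsuc))) ⟩
  ∑[ d ∈ Ds ] F fzero d * Π
    ≡⟨ *-distribʳ-∑ Ds Π (F fzero) ⟨
  ∑ Ds (F fzero) * Π
    ∎
  where
  Ds : List (Vec A (K fzero))
  Ds = allVecsOf xs (K fzero)
  Dss : List (Vecs A n (K ∘ fsuc))
  Dss = allVecs xs n (K ∘ fsuc)
  Π : ℕ
  Π = prodFin n (λ i → ∑ (allVecsOf xs (K (fsuc i))) (F (fsuc i)))

framed : ∀ {K} → A → Vec A K → A → Fin (suc (suc K)) → A
framed s d e fzero = s
framed s [] e (fsuc fzero) = e
framed s (r ∷ d) e (fsuc p) = framed r d e p

framed-last : ∀ {K} s (d : Vec A K) e → framed s d e last ≡ e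
framed-last s [] e = refl
framed-last s (r ∷ d) e = framed-last r d e

framed-inner : ∀ {K} s (d : Vec A K) e t → framed s d e (fsuc (inject₁ t)) ≡ lookup d t
framed-inner s (r ∷ d) e fzero = refl
framed-inner s (r ∷ d) e (fsuc t) = framed-inner r d e t

-- Colorings of a path in a cover

record IsMatching {C : Set} (R : C → C → Bool) : Set where
  field
    rightUnique : ∀ {a b b′} → R a b ≡ true → R a b′ ≡ true → b ≡ b′
    leftUnique  : ∀ {a a′ b} → R a b ≡ true → R a′ b ≡ true → a ≡ a′

cover-isMatching : ∀ {G m} (H : Cover G m) {x y} → x ≢ y → IsMatching (λ a b → adjH H x a y b)
cover-isMatching H x≢y = record
  { rightUnique = matching H _ _ _ _ _ x≢y
  ; leftUnique = λ e e′ → matching H _ _ _ _ _ (x≢y ∘ sym) (trans (adjH-sym H _ _ _ _) e) (trans (adjH-sym H _ _ _ _) e′)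
  }

module PathColorings (m′ : ℕ) where

  m : ℕ
  m = suc (suc m′)

  Col : Set
  Col = Fin m

  -- R t a b: the cover joins color a and color b at the ends of the t-th path edge.
  Conflicts : ℕ → Set
  Conflicts K = Fin (suc K) → Col → Col → Bool

  extend : (Col → Col → Bool) → (Col → ℕ) → Col → ℕ
  extend R z s = ∑< m (λ r → χ (not (R s r)) * z r)

  pathCount : ∀ K → Conflicts K → Col → Col → ℕ
  pathCount zero R s e = χ (not (R fzero s e))
  pathCount (suc K) R s e = extend (R fzero) (λ r → pathCount K (R ∘ fsuc) r e) s

  isPathColoring : ∀ {K} → Conflicts K → Col → Vec Col K → Col → Bool
  isPathColoring {zero} R s [] e = not (R fzero s e)
  isPathColoring {suc K} R s (r ∷ d) e = not (R fzero s r) ∧ isPathColoring (R ∘ fsuc) r d e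

  isPathColoring⇔ : ∀ {K} (R : Conflicts K) s d e → isPathColoring R s d e ≡ true ⇔
    (∀ t → R t (framed s d e (inject₁ t)) (framed s d e (fsuc t)) ≡ false)
  isPathColoring⇔ R s [] e = mk⇔ (λ { ok fzero → Boolₚ.not-injective ok }) (λ ok → cong not (ok fzero))
  isPathColoring⇔ R s (r ∷ d) e = mk⇔
    (λ ok → let (Rsr , rest) = Equivalence.to not∧≡true⇔ ok in
      λ { fzero → Rsr ; (fsuc t) → Equivalence.to (isPathColoring⇔ (R ∘ fsuc) r d e) rest t })
    (λ ok → Equivalence.from not∧≡true⇔ (ok fzero , Equivalence.from (isPathColoring⇔ (R ∘ fsuc) r d e) (ok ∘ fsuc)))

  ∑-isPathColoring : ∀ K R s e → ∑[ d ∈ allVecsOf (allFin m) K ] χ (isPathColoring R s d e) ≡ pathCount K R s e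
  ∑-isPathColoring zero R s e = +-identityʳ _
  ∑-isPathColoring (suc K) R s e = begin
    ∑[ d ∈ allVecsOf (allFin m) (suc K) ] χ (isPathColoring R s d e)
      ≡⟨ ∑-allVecsOf-suc (allFin m) K _ ⟩
    ∑[ d ∈ Ds ] ∑[ r ∈ allFin m ] χ (not (R fzero s r) ∧ isPathColoring R′ r d e)
      ≡⟨ ∑-cong Ds (λ d → ∑-cong (allFin m) (λ r → χ-∧ (not (R fzero s r)) _)) ⟩
    ∑[ d ∈ Ds ] ∑[ r ∈ allFin m ] χ (not (R fzero s r)) * χ (isPathColoring R′ r d e)
      ≡⟨ ∑-comm Ds (allFin m) _ ⟩
    ∑[ r ∈ allFin m ] ∑[ d ∈ Ds ] χ (not (R fzero s r)) * χ (isPathColoring R′ r d e)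
      ≡⟨ ∑-cong (allFin m) (λ r → sym (*-distribˡ-∑ Ds (χ (not (R fzero s r))) _)) ⟩
    ∑[ r ∈ allFin m ] χ (not (R fzero s r)) * (∑[ d ∈ Ds ] χ (isPathColoring R′ r d e))
      ≡⟨ ∑-cong (allFin m) (λ r → cong (χ (not (R fzero s r)) *_) (∑-isPathColoring K R′ r e)) ⟩
    ∑[ r ∈ allFin m ] χ (not (R fzero s r)) * pathCount K R′ r e
      ≡⟨ ∑-allFin m (λ r → χ (not (R fzero s r)) * pathCount K R′ r e) ⟩
    pathCount (suc K) R s e
      ∎
    where
    Ds : List (Vec Col K)
    Ds = allVecsOf (allFin m) K
    R′ : Conflicts K
    R′ = R ∘ fsuc

  -- Proper colorings of a path with K interior vertices and prescribed equal (P₌),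
  -- resp. distinct (P≠), end colors.
  P₌ P≠ : ℕ → ℕ
  P₌ zero = 0
  P₌ (suc K) = suc m′ * P≠ K
  P≠ zero = 1
  P≠ (suc K) = P₌ K + m′ * P≠ K

  P≠≡1+P₌-even : ∀ k → P≠ (k + k) ≡ suc (P₌ (k + k))
  P₌≡1+P≠-odd : ∀ k → P₌ (suc (k + k)) ≡ suc (P≠ (suc (k + k)))
  P≠≡1+P₌-even zero = refl
  P≠≡1+P₌-even (suc k) rewrite +-suc k k = cong (_+ m′ * P≠ (suc (k + k))) (P₌≡1+P≠-odd k)
  P₌≡1+P≠-odd k = cong (_+ m′ * P≠ (k + k)) (P≠≡1+P₌-even k)

  -- The invariant of the induction: z dominates the trivial cover's counts for some end color c.
  Dominates : ℕ → (Col → ℕ) → Set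
  Dominates K z = Σ Col λ c → P₌ K ≤ z c × (∀ s → s ≢ c → P≠ K ≤ z s)

  -- If no row is free, each row s conflicts with a unique color, never c, and these colors are
  -- distinct by the matching property: the m rows would inject into the m − 1 other colors.
  unmatchedRow : ∀ {R : Col → Col → Bool} {c} → IsMatching R → (∀ s → R s c ≡ false) →
    ∃ λ s₀ → ∀ r → R s₀ r ≡ false
  unmatchedRow {R} {c} M c-unmatched with Finₚ.any? (λ s → Finₚ.all? (λ r → R s r Boolₚ.≟ false))
  ... | yes freeRow = freeRow
  ... | no noFreeRow =
    contradiction (λ {s s′} → punchedPartner-injective {s} {s′}) (Finₚ.<⇒notInjective (n<1+n (suc m′)))
    where
    partner : ∀ s → ∃ λ r → R s r ≡ true
    partner s with Finₚ.any? (λ r → R s r Boolₚ.≟ true)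
    ... | yes p = p
    ... | no none = contradiction (s , λ r → Boolₚ.¬-not (none ∘ (r ,_))) noFreeRow
    c≢partner : ∀ s → c ≢ proj₁ (partner s)
    c≢partner s c≡r = contradiction
      (trans (sym (c-unmatched s)) (subst (λ r → R s r ≡ true) (sym c≡r) (proj₂ (partner s)))) λ ()
    punchedPartner-injective : Injective _≡_ _≡_ (λ s → punchOut (c≢partner s))
    punchedPartner-injective {s} {s′} e = IsMatching.leftUnique M (proj₂ (partner s))
      (subst (λ r → R s′ r ≡ true) (sym (Finₚ.punchOut-injective (c≢partner s) (c≢partner s′) e))
        (proj₂ (partner s′)))

  module _ {K} {R : Col → Col → Bool} {z : Col → ℕ} (M : IsMatching R) {c}
           (P₌≤zc : P₌ K ≤ z c) (P≠≤z : ∀ s → s ≢ c → P≠ K ≤ z s) where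

    open IsMatching M

    private
      allowed : ∀ {s r B} → R s r ≡ false → B ≤ z r → B ≤ χ (not (R s r)) * z r
      allowed {s} {r} Rsr≡false B≤zr rewrite Rsr≡false = ≤-trans B≤zr (≤-reflexive (sym (*-identityˡ (z r))))

    unrestrictedRow : ∀ s → (∀ r → R s r ≡ false) → P₌ K + suc m′ * P≠ K ≤ extend R z s
    unrestrictedRow s free = ∑<-remove-≥ (suc m′) c _ (allowed (free c) P₌≤zc)
      (λ r r≢c → allowed (free r) (P≠≤z r r≢c))

    blockedRow : ∀ s → R s c ≡ true → P₌ (suc K) ≤ extend R z s
    blockedRow s Rsc = ∑<-remove-≥ (suc m′) c _ z≤n
      (λ r r≢c → allowed (Boolₚ.¬-not (λ Rsr → r≢c (rightUnique Rsr Rsc))) (P≠≤z r r≢c))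

    allowedRow : ∀ s → R s c ≡ false → P≠ (suc K) ≤ extend R z s
    allowedRow s Rsc≡false with Finₚ.any? (λ r → R s r Boolₚ.≟ true)
    ... | yes (r₁ , Rsr₁) = ∑<-remove₂-≥ m′ _ c≢r₁ (allowed Rsc≡false P₌≤zc)
      (λ r r≢c r≢r₁ → allowed (Boolₚ.¬-not (λ Rsr → r≢r₁ (rightUnique Rsr Rsr₁))) (P≠≤z r r≢c))
      where
      c≢r₁ : c ≢ r₁
      c≢r₁ refl = contradiction (trans (sym Rsc≡false) Rsr₁) λ ()
    ... | no none = ≤-trans (+-monoʳ-≤ (P₌ K) (*-monoˡ-≤ (P≠ K) (n≤1+n m′)))
      (unrestrictedRow s (λ r → Boolₚ.¬-not (none ∘ (r ,_))))

  dominates-extend : ∀ {K R z} → IsMatching R → Dominates K z → Dominates (suc K) (extend R z)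
  dominates-extend {K} {R} M (c , P₌≤zc , P≠≤z) with Finₚ.any? (λ s → R s c Boolₚ.≟ true)
  ... | yes (s₁ , Rs₁c) = s₁ , blockedRow {K} M P₌≤zc P≠≤z s₁ Rs₁c ,
    λ s s≢s₁ → allowedRow {K} M P₌≤zc P≠≤z s (Boolₚ.¬-not (λ Rsc → s≢s₁ (IsMatching.leftUnique M Rsc Rs₁c)))
  ... | no c-unmatched = s₀ , ≤-trans (m≤n+m _ (P₌ K)) (unrestrictedRow {K} M P₌≤zc P≠≤z s₀ (proj₂ free)) ,
    λ s _ → allowedRow {K} M P₌≤zc P≠≤z s (R-c s)
    where
    R-c : ∀ s → R s c ≡ false
    R-c s = Boolₚ.¬-not (c-unmatched ∘ (s ,_))
    free : ∃ λ s₀ → ∀ r → R s₀ r ≡ false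
    free = unmatchedRow M R-c
    s₀ : Col
    s₀ = proj₁ free

  dominates-pathCount : ∀ K (R : Conflicts K) e → (∀ t → IsMatching (R t)) → Dominates K (λ s → pathCount K R s e)
  dominates-pathCount zero R e M with Finₚ.any? (λ s → R fzero s e Boolₚ.≟ true)
  ... | yes (s₀ , Rs₀e) = s₀ , z≤n , λ s s≢s₀ →
    ≤-reflexive (cong (χ ∘ not) (sym (Boolₚ.¬-not (λ Rse → s≢s₀ (IsMatching.leftUnique (M fzero) Rse Rs₀e)))))
  ... | no none = fzero , z≤n , λ s _ → ≤-reflexive (cong (χ ∘ not) (sym (Boolₚ.¬-not (none ∘ (s ,_)))))
  dominates-pathCount (suc K) R e M = dominates-extend {K} (M fzero) (dominates-pathCount K (R ∘ fsuc) e (M ∘ fsuc))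

  pathCount-cong : ∀ K {R R′ : Conflicts K} → (∀ t a b → R t a b ≡ R′ t a b) →
    ∀ s e → pathCount K R s e ≡ pathCount K R′ s e
  pathCount-cong zero R≗R′ s e = cong (χ ∘ not) (R≗R′ fzero s e)
  pathCount-cong (suc K) R≗R′ s e = sum-cong-≗ (λ r →
    cong₂ (λ b c → χ (not b) * c) (R≗R′ fzero s r) (pathCount-cong K (R≗R′ ∘ fsuc) r e))

  atMostOneConflict : ∀ {R : Col → Col → Bool} → IsMatching R → ∀ a → Σ Col λ c → ∀ b → b ≢ c → R a b ≡ false
  atMostOneConflict {R} M a with Finₚ.any? (λ b → R a b Boolₚ.≟ true)
  ... | yes (c , Rac) = c , λ b b≢c → Boolₚ.¬-not (λ Rab → b≢c (IsMatching.rightUnique M Rab Rac))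
  ... | no none = fzero , λ b _ → Boolₚ.¬-not (none ∘ (b ,_))

  suc-m′≤allowed : ∀ {R : Col → Col → Bool} → IsMatching R → ∀ a → suc m′ ≤ ∑< m (λ b → χ (not (R a b)))
  suc-m′≤allowed {R} M a with atMostOneConflict M a
  ... | c , noConflict = subst (_≤ ∑< m (λ b → χ (not (R a b)))) (*-identityʳ (suc m′))
    (∑<-remove-≥ (suc m′) c (λ b → χ (not (R a b))) z≤n
      (λ b b≢c → ≤-reflexive (cong (χ ∘ not) (sym (noConflict b b≢c)))))

  -- For odd K we have P₌ K = 1 + P≠ K, so the exceptional color c also gets at least P≠ K.
  P≠≤pathCount : ∀ {K k} → K ≡ suc (k + k) → (R : Conflicts K) → (∀ t → IsMatching (R t)) →
    ∀ s e → P≠ K ≤ pathCount K R s e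
  P≠≤pathCount {K} {k} refl R M s e with dominates-pathCount K R e M
  ... | c , P₌≤zc , P≠≤z with s ≟ c
  ... | yes refl = ≤-trans (≤-trans (n≤1+n _) (≤-reflexive (sym (P₌≡1+P≠-odd k)))) P₌≤zc
  ... | no s≢c = P≠≤z s s≢c

  equalityConflicts : ∀ {K} → Conflicts K
  equalityConflicts t a b = does (a ≟ b)

  private
    term-≡ : ∀ {s r : Col} n → s ≡ r → χ (not (does (s ≟ r))) * n ≡ 0
    term-≡ {s} n refl = cong (λ b → χ (not b) * n) (dec-true (s ≟ s) refl)
    term-≢ : ∀ {s r : Col} n → s ≢ r → χ (not (does (s ≟ r))) * n ≡ n
    term-≢ {s} {r} n s≢r = trans (cong (λ b → χ (not b) * n) (dec-false (s ≟ r) s≢r)) (*-identityˡ n)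

  pathCount-equality-≡ : ∀ K e → pathCount K equalityConflicts e e ≡ P₌ K
  pathCount-equality-≢ : ∀ K {s e} → s ≢ e → pathCount K equalityConflicts s e ≡ P≠ K
  pathCount-equality-≡ zero e = cong (χ ∘ not) (dec-true (e ≟ e) refl)
  pathCount-equality-≡ (suc K) e =
    ∑<-remove-≡ (suc m′) e (λ r → χ (not (does (e ≟ r))) * pathCount K equalityConflicts r e)
      (term-≡ {e} _ refl) (λ r r≢e → trans (term-≢ _ (r≢e ∘ sym)) (pathCount-equality-≢ K r≢e))
  pathCount-equality-≢ zero {s} {e} s≢e = cong (χ ∘ not) (dec-false (s ≟ e) s≢e)
  pathCount-equality-≢ (suc K) {s} {e} s≢e =
    ∑<-remove₂-≡ m′ (λ r → χ (not (does (s ≟ r))) * pathCount K equalityConflicts r e) s≢e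
      (term-≡ {s} _ refl) (trans (term-≢ _ s≢e) (pathCount-equality-≡ K e))
      (λ r r≢s r≢e → trans (term-≢ _ (r≢s ∘ sym)) (pathCount-equality-≢ K r≢e))

-- The trivial cover

module _ (G : Graph) (m : ℕ) where

  trivialAdj : Fin (V G) → Fin m → Fin (V G) → Fin m → Bool
  trivialAdj x i y j = if does (x ≟ y) then not (does (i ≟ j)) else (adj G x y ∧ does (i ≟ j))

  trivialCover : Cover G m
  trivialCover = record
    { adjH = trivialAdj ; adjH-sym = symmetric ; adjH-irr = irreflexive ; clique = clique′
    ; respects = respects′ ; matching = matching′ }
    where
    ≟-sym : ∀ {k} (a b : Fin k) → does (a ≟ b) ≡ does (b ≟ a)
    ≟-sym a b with a ≟ b | b ≟ a
    ... | yes _ | yes _ = refl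
    ... | yes a≡b | no b≢a = contradiction (sym a≡b) b≢a
    ... | no a≢b | yes b≡a = contradiction (sym b≡a) a≢b
    ... | no _ | no _ = refl
    symmetric : ∀ x i y j → trivialAdj x i y j ≡ trivialAdj y j x i
    symmetric x i y j rewrite ≟-sym x y | ≟-sym i j | adj-sym G x y = refl
    irreflexive : ∀ x i → trivialAdj x i x i ≡ false
    irreflexive x i rewrite dec-true (x ≟ x) refl | dec-true (i ≟ i) refl = refl
    clique′ : ∀ x i j → i ≢ j → trivialAdj x i x j ≡ true
    clique′ x i j i≢j rewrite dec-true (x ≟ x) refl | dec-false (i ≟ j) i≢j = refl
    respects′ : ∀ x i y j → x ≢ y → trivialAdj x i y j ≡ true → adj G x y ≡ true
    respects′ x i y j x≢y e rewrite dec-false (x ≟ y) x≢y with adj G x y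
    ... | true = refl
    matching′ : ∀ x y i j j′ → x ≢ y → trivialAdj x i y j ≡ true → trivialAdj x i y j′ ≡ true → j ≡ j′
    matching′ x y i j j′ x≢y e e′ rewrite dec-false (x ≟ y) x≢y with adj G x y | i ≟ j | i ≟ j′
    ... | true | yes refl | yes refl = refl

  trivialAdj-edge : ∀ {x y} → adj G x y ≡ true → ∀ i j → trivialAdj x i y j ≡ does (i ≟ j)
  trivialAdj-edge {x} {y} xy i j with x ≟ y
  ... | yes refl = contradiction (trans (sym (adj-irr G x)) xy) λ ()
  ... | no _ rewrite xy = refl

-- Gluing cycles along an edge

module Gluing {n′ : ℕ} {Gs : Fin (suc n′) → Graph} {u v : (i : Fin (suc n′)) → Fin (V (Gs i))}
  {G : Graph} {φ : (i : Fin (suc n′)) → Fin (V (Gs i)) → Fin (V G)} (glued : IsGluing Gs u v G φ)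
  (cp : ∀ i → CyclePath (Gs i) (u i) (v i)) (m′ : ℕ) where

  open IsGluing glued
  open PathColorings m′

  n : ℕ
  n = suc n′

  K : Fin n → ℕ
  K i = CyclePath.K (cp i)

  pos : ∀ i → Fin (V (Gs i)) → Pos (K i)
  pos i = CyclePath.pos (cp i)

  vert : ∀ i → Pos (K i) → Fin (V (Gs i))
  vert i = CyclePath.vert (cp i)

  W : ∀ i → Pos (K i) → Fin (V G)
  W i p = φ i (vert i p)

  uG vG : Fin (V G)
  uG = φ fzero (u fzero)
  vG = φ fzero (v fzero)

  W-zero : ∀ i → W i fzero ≡ uG
  W-zero i = trans (cong (φ i) (vert-zero (cp i))) (glue-u i fzero)

  W-last : ∀ i → W i last ≡ vG
  W-last i = trans (cong (φ i) (vert-last (cp i))) (glue-v i fzero)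

  φ≡W : ∀ i w {p} → pos i w ≡ p → φ i w ≡ W i p
  φ≡W i w refl = cong (φ i) (sym (CyclePath.vert-pos (cp i) w))

  -- A coloring of G, split into the colors of u and v and the interior colors of every path.
  Split : Set
  Split = Col × Col × Vecs Col n K

  interior : Vecs Col n K → (i : Fin n) → Vec Col (K i)
  interior = lookupᵛ

  interiors : ((i : Fin n) → Vec Col (K i)) → Vecs Col n K
  interiors = tabulateᵛ

  pathColor : ∀ i → Split → Pos (K i) → Col
  pathColor i (a , b , ds) = framed a (interior ds i) b

  pathColor-u : ∀ i d → pathColor i d (pos i (u i)) ≡ proj₁ d
  pathColor-u i d = cong (pathColor i d) (CyclePath.pos-u (cp i))

  pathColor-v : ∀ i d → pathColor i d (pos i (v i)) ≡ proj₁ (proj₂ d)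
  pathColor-v i d@(a , b , ds) = trans (cong (pathColor i d) (CyclePath.pos-v (cp i))) (framed-last a (interior ds i) b)

  Preimage : Fin (V G) → Set
  Preimage x = Σ (Fin n) λ i → Σ (Fin (V (Gs i))) λ w → φ i w ≡ x

  colorVia : Split → ∀ {x} → Preimage x → Col
  colorVia d (i , w , _) = pathColor i d (pos i w)

  colorVia-φ : ∀ d j w (σ : Preimage (φ j w)) → colorVia d σ ≡ pathColor j d (pos j w)
  colorVia-φ d j w (i , w′ , eq) with only i j w′ w eq
  ... | inj₁ (refl , refl) = refl
  ... | inj₂ (inj₁ (refl , refl)) = trans (pathColor-u i d) (sym (pathColor-u j d))
  ... | inj₂ (inj₂ (refl , refl)) = trans (pathColor-v i d) (sym (pathColor-v j d))

  colorAt : Split → Fin (V G) → Col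
  colorAt d x = colorVia d (onto x)

  colorAt-φ : ∀ d j w → colorAt d (φ j w) ≡ pathColor j d (pos j w)
  colorAt-φ d j w = colorVia-φ d j w (onto (φ j w))

  colorAt-W : ∀ d i p → colorAt d (W i p) ≡ pathColor i d p
  colorAt-W d i p = trans (colorAt-φ d i (vert i p)) (cong (pathColor i d) (CyclePath.pos-vert (cp i) p))

  colorAt-uG : ∀ d → colorAt d uG ≡ proj₁ d
  colorAt-uG d = trans (colorAt-φ d fzero (u fzero)) (pathColor-u fzero d)

  colorAt-vG : ∀ d → colorAt d vG ≡ proj₁ (proj₂ d)
  colorAt-vG d = trans (colorAt-φ d fzero (v fzero)) (pathColor-v fzero d)

  join : Split → Vec Col (V G)
  join d = tabulate (colorAt d)

  interiorOf : Vec Col (V G) → (i : Fin n) → Vec Col (K i)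
  interiorOf c i = tabulate (λ t → lookup c (W i (fsuc (inject₁ t))))

  split : Vec Col (V G) → Split
  split c = lookup c uG , lookup c vG , interiors (interiorOf c)

  lookup-join : ∀ d x → lookup (join d) x ≡ colorAt d x
  lookup-join d x = Vecₚ.lookup∘tabulate (colorAt d) x

  split∘join : ∀ d → split (join d) ≡ d
  split∘join d@(a , b , ds) = cong₂ _,_ (trans (lookup-join d uG) (colorAt-uG d))
    (cong₂ _,_ (trans (lookup-join d vG) (colorAt-vG d)) (begin
      interiors (interiorOf (join d))
        ≡⟨ tabulateᵛ-cong (λ i → trans (Vecₚ.tabulate-cong (inner i)) (Vecₚ.tabulate∘lookup (interior ds i))) ⟩
      interiors (interior ds)
        ≡⟨ tabulateᵛ∘lookupᵛ {K = K} ds ⟩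
      ds ∎))
    where
    inner : ∀ i t → lookup (join d) (W i (fsuc (inject₁ t))) ≡ lookup (interior ds i) t
    inner i t = trans (lookup-join d _) (trans (colorAt-W d i _) (framed-inner a (interior ds i) b t))

  pathColor-split : ∀ c i w → pathColor i (split c) (pos i w) ≡ lookup c (φ i w)
  pathColor-split c i w with positionView (pos i w)
  ... | inj₁ p≡0 = begin
    pathColor i (split c) (pos i w)   ≡⟨ cong (pathColor i (split c)) p≡0 ⟩
    lookup c uG                       ≡⟨ cong (lookup c) (trans (φ≡W i w p≡0) (W-zero i)) ⟨
    lookup c (φ i w)                  ∎
  ... | inj₂ (inj₁ p≡last) = begin
    pathColor i (split c) (pos i w)   ≡⟨ cong (pathColor i (split c)) p≡last ⟩
    pathColor i (split c) last        ≡⟨ framed-last _ (interior (interiors (interiorOf c)) i) _ ⟩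
    lookup c vG                       ≡⟨ cong (lookup c) (trans (φ≡W i w p≡last) (W-last i)) ⟨
    lookup c (φ i w)                  ∎
  ... | inj₂ (inj₂ (t , p≡inner)) = begin
    pathColor i (split c) (pos i w)                 ≡⟨ cong (pathColor i (split c)) p≡inner ⟩
    pathColor i (split c) (fsuc (inject₁ t))        ≡⟨ framed-inner _ (interior (interiors (interiorOf c)) i) _ t ⟩
    lookup (interior (interiors (interiorOf c)) i) t ≡⟨ cong (λ d → lookup d t) (lookupᵛ∘tabulateᵛ {K = K} (interiorOf c) i) ⟩
    lookup (interiorOf c i) t                       ≡⟨ Vecₚ.lookup∘tabulate _ t ⟩
    lookup c (W i (fsuc (inject₁ t)))               ≡⟨ cong (lookup c) (φ≡W i w p≡inner) ⟨
    lookup c (φ i w)                                ∎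

  join∘split : ∀ c → join (split c) ≡ c
  join∘split c = trans (Vecₚ.tabulate-cong (λ x → colorVia-split x (onto x))) (Vecₚ.tabulate∘lookup c)
    where
    colorVia-split : ∀ x (σ : Preimage x) → colorVia (split c) σ ≡ lookup c x
    colorVia-split x (i , w , refl) = pathColor-split c i w

  lookup-join-W : ∀ d i p → lookup (join d) (W i p) ≡ pathColor i d p
  lookup-join-W d i p = trans (lookup-join d (W i p)) (colorAt-W d i p)

  join-injective : ∀ {d d′} → join d ≡ join d′ → d ≡ d′
  join-injective {d} {d′} e = trans (sym (split∘join d)) (trans (cong split e) (split∘join d′))

  splits : List Split
  splits = cartesianProduct (allFin m) (cartesianProduct (allFin m) (allVecs (allFin m) n K))

  _≟ᵛ_ : DecidableEquality (Vecs Col n K)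
  _≟ᵛ_ = ≡-decᵛ _≟_ {n} {K}

  _≟ˢ_ : DecidableEquality Split
  _≟ˢ_ = Productₚ.≡-dec _≟_ (Productₚ.≡-dec _≟_ _≟ᵛ_)

  splits-isEnumeration : IsEnumeration _≟ˢ_ splits
  splits-isEnumeration =
    cartesianProduct-isEnumeration {_≟A_ = _≟_} {_≟B_ = Productₚ.≡-dec _≟_ _≟ᵛ_}
      (allFin m) (cartesianProduct (allFin m) (allVecs (allFin m) n K)) (allFin-isEnumeration m)
      (cartesianProduct-isEnumeration {_≟A_ = _≟_} {_≟B_ = _≟ᵛ_} (allFin m) (allVecs (allFin m) n K)
        (allFin-isEnumeration m) (allVecs-isEnumeration {_≟_ = _≟_} (allFin-isEnumeration m) n K))

  module Counting (H : Cover G m) where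

    uvConflict : Col → Col → Bool
    uvConflict a b = adjH H uG a vG b

    pathConflicts : ∀ i → Conflicts (K i)
    pathConflicts i t a b = adjH H (W i (inject₁ t)) a (W i (fsuc t)) b

    isProperSplit : Split → Bool
    isProperSplit (a , b , ds) =
      not (uvConflict a b) ∧ allᶠ n (λ i → isPathColoring (pathConflicts i) a (interior ds i) b)

    IsProperSplit : Split → Set
    IsProperSplit d@(a , b , _) = uvConflict a b ≡ false ×
      (∀ i t → pathConflicts i t (pathColor i d (inject₁ t)) (pathColor i d (fsuc t)) ≡ false)

    isProperSplit⇔ : ∀ d → isProperSplit d ≡ true ⇔ IsProperSplit d
    isProperSplit⇔ d@(a , b , ds) = mk⇔
      (λ ok → let (uv , paths) = to not∧≡true⇔ ok in
        uv , λ i → to (isPathColoring⇔ (pathConflicts i) a (interior ds i) b) (to (allᶠ≡true⇔ n pathOK) paths i))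
      (λ (uv , paths) → from not∧≡true⇔
        (uv , from (allᶠ≡true⇔ n pathOK) (λ i → from (isPathColoring⇔ (pathConflicts i) a (interior ds i) b) (paths i))))
      where
      open Equivalence
      pathOK : Fin n → Bool
      pathOK i = isPathColoring (pathConflicts i) a (interior ds i) b

    proper-join⇒ : ∀ d → IsProper H (join d) → IsProperSplit d
    proper-join⇒ d proper =
      trans (cong₂ (λ c c′ → adjH H uG c vG c′) (sym (trans (lookup-join d uG) (colorAt-uG d)))
                                               (sym (trans (lookup-join d vG) (colorAt-vG d))))
            (proper uG vG) ,
      λ i t → trans (cong₂ (λ c c′ → adjH H (W i (inject₁ t)) c (W i (fsuc t)) c′)
                           (sym (lookup-join-W d i (inject₁ t))) (sym (lookup-join-W d i (fsuc t))))
                    (proper (W i (inject₁ t)) (W i (fsuc t)))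

    cycleEdge-free : ∀ d → IsProperSplit d → ∀ i {p q} → CycleAdj p q →
      adjH H (W i p) (pathColor i d p) (W i q) (pathColor i d q) ≡ false
    cycleEdge-free d@(a , b , ds) (uv , paths) i (inj₁ p→q) = step-free p→q
      where
      step-free : ∀ {p q} → CycleStep p q → adjH H (W i p) (pathColor i d p) (W i q) (pathColor i d q) ≡ false
      step-free (inj₁ (t , refl , refl)) = paths i t
      step-free (inj₂ (refl , refl)) rewrite W-last i | W-zero i | framed-last a (interior ds i) b =
        trans (adjH-sym H vG b uG a) uv
    cycleEdge-free d ok i (inj₂ q→p) = trans (adjH-sym H _ _ _ _) (cycleEdge-free d ok i (inj₁ q→p))

    edge-free : ∀ d → IsProperSplit d → ∀ i a b → adj (Gs i) a b ≡ true →
      adjH H (φ i a) (lookup (join d) (φ i a)) (φ i b) (lookup (join d) (φ i b)) ≡ false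
    edge-free d ok i a b ab = begin
      adjH H (φ i a) (lookup (join d) (φ i a)) (φ i b) (lookup (join d) (φ i b))
        ≡⟨ cong₂ (λ c c′ → adjH H (φ i a) c (φ i b) c′) (color a) (color b) ⟩
      adjH H (φ i a) (pathColor i d (pos i a)) (φ i b) (pathColor i d (pos i b))
        ≡⟨ cong₂ (λ x y → adjH H x (pathColor i d (pos i a)) y (pathColor i d (pos i b))) (φ≡W i a refl) (φ≡W i b refl) ⟩
      adjH H (W i (pos i a)) (pathColor i d (pos i a)) (W i (pos i b)) (pathColor i d (pos i b))
        ≡⟨ cycleEdge-free d ok i (CyclePath.adj⇒cycleAdj (cp i) a b ab) ⟩
      false ∎
      where
      color : ∀ w → lookup (join d) (φ i w) ≡ pathColor i d (pos i w)
      color w = trans (lookup-join d (φ i w)) (colorAt-φ d i w)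

    ⇒proper-join : ∀ d → IsProperSplit d → IsProper H (join d)
    ⇒proper-join d ok x y with x ≟ y
    ... | yes refl = adjH-irr H x _
    ... | no x≢y = Boolₚ.¬-not (λ conflict → not-an-edge (edges x y (respects H x _ y _ x≢y conflict)) conflict)
      where
      not-an-edge : (Σ (Fin n) λ i → Σ (Fin (V (Gs i))) λ a → Σ (Fin (V (Gs i))) λ b →
                      φ i a ≡ x × φ i b ≡ y × adj (Gs i) a b ≡ true) →
                    adjH H x (lookup (join d) x) y (lookup (join d) y) ≢ true
      not-an-edge (i , a , b , refl , refl , ab) conflict = contradiction (trans (sym (edge-free d ok i a b ab)) conflict) λ ()

    interiorColorings : Col → Col → ℕ
    interiorColorings a b = prodFin n (λ i → pathCount (K i) (pathConflicts i) a b)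

    coloringsWith : Col → Col → ℕ
    coloringsWith a b = χ (not (uvConflict a b)) * interiorColorings a b

    ∑-isProperSplit : ∀ a b → ∑[ ds ∈ allVecs (allFin m) n K ] χ (isProperSplit (a , b , ds)) ≡ coloringsWith a b
    ∑-isProperSplit a b = begin
      ∑[ ds ∈ Dss ] χ (isProperSplit (a , b , ds))
        ≡⟨ ∑-cong Dss (λ ds → trans (χ-∧ (not (uvConflict a b)) _)
             (cong (χ (not (uvConflict a b)) *_) (χ-allᶠ n (λ i → isPathColoring (pathConflicts i) a (interior ds i) b)))) ⟩
      ∑[ ds ∈ Dss ] χ (not (uvConflict a b)) * prodFin n (λ i → pathColorings i (interior ds i))
        ≡⟨ *-distribˡ-∑ Dss (χ (not (uvConflict a b))) _ ⟨
      χ (not (uvConflict a b)) * (∑[ ds ∈ Dss ] prodFin n (λ i → pathColorings i (interior ds i)))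
        ≡⟨ cong (χ (not (uvConflict a b)) *_) (∑-allVecs-prodFin (allFin m) n K pathColorings) ⟩
      χ (not (uvConflict a b)) * prodFin n (λ i → ∑ (allVecsOf (allFin m) (K i)) (pathColorings i))
        ≡⟨ cong (χ (not (uvConflict a b)) *_) (prodFin-cong n (λ i → ∑-isPathColoring (K i) (pathConflicts i) a b)) ⟩
      coloringsWith a b
        ∎
      where
      Dss : List (Vecs Col n K)
      Dss = allVecs (allFin m) n K
      pathColorings : (i : Fin n) → Vec Col (K i) → ℕ
      pathColorings i d = χ (isPathColoring (pathConflicts i) a d b)

    numColorings≡ : numColorings H ≡ ∑< m (λ a → ∑< m (coloringsWith a))
    numColorings≡ = begin
      numColorings H
        ≡⟨ numColorings≡∑ H ⟩
      ∑[ c ∈ allVecsOf (allFin m) (V G) ] χ (isHColoring H (map ⁅_⁆ c))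
        ≡⟨ ∑-injection (Vecₚ.≡-dec _≟_) _≟ˢ_ (allVecsOf (allFin m) (V G)) splits
             (allVecsOf-isEnumeration (allFin-isEnumeration m) (V G)) splits-isEnumeration
             join join-injective _ (λ c _ → split c , join∘split c) ⟩
      ∑[ d ∈ splits ] χ (isHColoring H (map ⁅_⁆ (join d)))
        ≡⟨ ∑-cong splits (λ d → χ-cong (⇔-trans (isHColoring⇔IsProper H (join d))
             (⇔-trans (mk⇔ (proper-join⇒ d) (⇒proper-join d)) (⇔-sym (isProperSplit⇔ d))))) ⟩
      ∑[ d ∈ splits ] χ (isProperSplit d)
        ≡⟨ ∑-cartesianProduct (allFin m) (cartesianProduct (allFin m) Dss) (χ ∘ isProperSplit) ⟩
      (∑[ a ∈ allFin m ] ∑[ bds ∈ cartesianProduct (allFin m) Dss ] χ (isProperSplit (a , bds)))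
        ≡⟨ ∑-cong (allFin m) (λ a → ∑-cartesianProduct (allFin m) Dss (λ bds → χ (isProperSplit (a , bds)))) ⟩
      (∑[ a ∈ allFin m ] ∑[ b ∈ allFin m ] ∑[ ds ∈ Dss ] χ (isProperSplit (a , b , ds)))
        ≡⟨ ∑-cong (allFin m) (λ a → ∑-cong (allFin m) (∑-isProperSplit a)) ⟩
      (∑[ a ∈ allFin m ] ∑[ b ∈ allFin m ] coloringsWith a b)
        ≡⟨ ∑-allFin m (λ a → ∑[ b ∈ allFin m ] coloringsWith a b) ⟩
      ∑< m (λ a → ∑[ b ∈ allFin m ] coloringsWith a b)
        ≡⟨ sum-cong-≗ (λ a → ∑-allFin m (coloringsWith a)) ⟩
      ∑< m (λ a → ∑< m (coloringsWith a))
        ∎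
      where
      Dss : List (Vecs Col n K)
      Dss = allVecs (allFin m) n K

  Q : ℕ
  Q = prodFin n (λ i → P≠ (K i))

  W-adj : ∀ i t → adj G (W i (inject₁ t)) (W i (fsuc t)) ≡ true
  W-adj i t = edges← i _ _ (CyclePath.path-adj (cp i) t)

  uG-vG-adj : adj G uG vG ≡ true
  uG-vG-adj = edges← fzero (u fzero) (v fzero) (CyclePath.adj-u-v (cp fzero))

  adj⇒≢ : ∀ {x y} → adj G x y ≡ true → x ≢ y
  adj⇒≢ {x} xy refl = contradiction (trans (sym (adj-irr G x)) xy) λ ()

  numColorings-lower : ∀ H → m * (suc m′ * Q) ≤ numColorings H
  numColorings-lower H = subst₂ _≤_ (∑<-const m (suc m′ * Q)) (sym numColorings≡) (∑<-mono-≤ m rowBound)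
    where
    open Counting H
    uv-matching : IsMatching uvConflict
    uv-matching = cover-isMatching H (adj⇒≢ uG-vG-adj)
    Q≤ : ∀ a b → Q ≤ interiorColorings a b
    Q≤ a b = prodFin-mono-≤ n (λ i → P≠≤pathCount {k = CyclePath.k (cp i)} (CyclePath.K≡1+k+k (cp i)) (pathConflicts i)
      (λ t → cover-isMatching H (adj⇒≢ (W-adj i t))) a b)
    allowed : Col → Col → ℕ
    allowed a b = χ (not (uvConflict a b))
    rowBound : ∀ a → suc m′ * Q ≤ ∑< m (coloringsWith a)
    rowBound a = ≤-trans (*-monoˡ-≤ Q (suc-m′≤allowed uv-matching a))
      (≤-trans (≤-reflexive (*-distribʳ-sum Q (allowed a)))
        (∑<-mono-≤ m {λ b → allowed a b * Q} (λ b → *-monoʳ-≤ (allowed a b) (Q≤ a b))))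

  numColorings-trivial : numColorings (trivialCover G m) ≡ m * (suc m′ * Q)
  numColorings-trivial = trans numColorings≡ (trans (sum-cong-≗ row) (∑<-const m (suc m′ * Q)))
    where
    open Counting (trivialCover G m)
    interiorColorings-≢ : ∀ {a b} → a ≢ b → interiorColorings a b ≡ Q
    interiorColorings-≢ a≢b = prodFin-cong n (λ i → trans
      (pathCount-cong (K i) (λ t → trivialAdj-edge G m (W-adj i t)) _ _) (pathCount-equality-≢ (K i) a≢b))
    row : ∀ a → ∑< m (coloringsWith a) ≡ suc m′ * Q
    row a = ∑<-remove-≡ (suc m′) a (coloringsWith a)
      (cong (λ c → χ (not c) * interiorColorings a a) (trans (trivialAdj-edge G m uG-vG-adj a a) (dec-true (a ≟ a) refl)))
      (λ b b≢a → trans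
        (cong (λ c → χ (not c) * interiorColorings a b)
              (trans (trivialAdj-edge G m uG-vG-adj a b) (dec-false (a ≟ b) (b≢a ∘ sym))))
        (trans (*-identityˡ _) (interiorColorings-≢ (b≢a ∘ sym))))

  isPDP⇒≡ : ∀ {p} → IsPDP G m p → p ≡ m * suc m′ * Q
  isPDP⇒≡ ((H , H≡p) , minimal) = trans (≤-antisym
    (≤-trans (minimal (trivialCover G m)) (≤-reflexive numColorings-trivial))
    (subst (m * (suc m′ * Q) ≤_) H≡p (numColorings-lower H))) (sym (*-assoc m (suc m′) Q))

gluing-single : ∀ (Gi : Graph) (ui vi : Fin (V Gi)) → IsGluing {1} (λ _ → Gi) (λ _ → ui) (λ _ → vi) Gi (λ _ x → x)
gluing-single Gi ui vi = record
  { glue-u = λ _ _ → refl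
  ; glue-v = λ _ _ → refl
  ; only = λ { fzero fzero a b a≡b → inj₁ (refl , a≡b) }
  ; onto = λ x → fzero , x , refl
  ; edges = λ x y xy → fzero , x , y , refl , refl , xy
  ; edges← = λ _ _ _ ab → ab
  }

corollary14 : (n : ℕ) → 2 ≤ n → (Gs : Fin n → Graph) → (∀ i → IsOddCycle (Gs i)) →
    (u v : (i : Fin n) → Fin (V (Gs i))) → (∀ i → adj (Gs i) (u i) (v i) ≡ true) →
    (G : Graph) → (φ : (i : Fin n) → Fin (V (Gs i)) → Fin (V G)) → IsGluing Gs u v G φ →
    (m : ℕ) → 2 ≤ m → (ps : Fin n → ℕ) → (∀ i → IsPDP (Gs i) m (ps i)) →
    (p : ℕ) → IsPDP G m p →
    p * (m * (m ∸ 1)) ^ (n ∸ 1) ≡ prodFin n ps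
corollary14 (suc n′) (s≤s _) Gs odd u v uv G φ glued (suc (suc m′)) (s≤s (s≤s _)) ps ps-PDP p p-PDP = begin
  p * c ^ n′                       ≡⟨ cong (_* c ^ n′) (Gluing.isPDP⇒≡ glued cp m′ p-PDP) ⟩
  c * Q * c ^ n′                   ≡⟨ *-assoc c Q (c ^ n′) ⟩
  c * (Q * c ^ n′)                 ≡⟨ cong (c *_) (*-comm Q (c ^ n′)) ⟩
  c * (c ^ n′ * Q)                 ≡⟨ *-assoc c (c ^ n′) Q ⟨
  c ^ suc n′ * Q                   ≡⟨ prodFin-scale (suc n′) c D ⟨
  prodFin (suc n′) (λ i → c * D i) ≡⟨ prodFin-cong (suc n′) ps≡ ⟨
  prodFin (suc n′) ps              ∎
  where
  open PathColorings m′ using (m; P≠)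
  cp : ∀ i → CyclePath (Gs i) (u i) (v i)
  cp i = oddCycle⇒cyclePath (odd i) (uv i)
  c : ℕ
  c = m * suc m′
  D : Fin (suc n′) → ℕ
  D i = P≠ (CyclePath.K (cp i))
  Q : ℕ
  Q = prodFin (suc n′) D
  ps≡ : ∀ i → ps i ≡ c * D i
  ps≡ i = trans (Gluing.isPDP⇒≡ (gluing-single (Gs i) (u i) (v i)) (λ _ → cp i) m′ (ps-PDP i))
    (cong (c *_) (*-identityʳ (D i)))
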